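{- Let $\lambda$ be a Young diagram fitting inside the $k\times(n-k)$ rectangle. Then $$X_\lambda\cdot\mathbf 1=w_\lambda(\mathbf 1)+\sum_{\varepsilon\in E}f_\varepsilon\,\varepsilon\quad\text{for some } f_\varepsilon\in O(v).$$
   Context: For an integer $m$, $O(v^m)$ denotes the set of $f\in\mathbb Q(v)$ having a zero of order $\ge m$ at $v=0$ (i.e. $v^{ -m}f$ is regular at $v=0$). Fix integers $1\le k\le n-1$. Let $\mathcal H$ be the Hecke algebra of $S_n$ over $\mathbb Q(v)$: generated by $T_1,\dots,T_{n-1}$ with braid relations and $(T_i-v)(T_i+v^{ -1})=0$. Let $E$ be the set of sequences $\varepsilon\in\{+,-\}^n$ with exactly $k$ pluses; $S_n$ acts by permuting positions, $s_i=(i,i+1)$. Let $M=\bigoplus_{\varepsilon\in E}\mathbb Q(v)\varepsilon$ with $\mathcal H$-action: $T_i\varepsilon=s_i\varepsilon$ if $(\varepsilon_i,\varepsilon_{i+1})=(+,-)$; $T_i\varepsilon=-v^{ -1}\varepsilon$ if $(\varepsilon_i,\varepsilon_{i+1})\in\{(-,-),(+,+)\}$; $T_i\varepsilon=s_i\varepsilon+(v-v^{ -1})\varepsilon$ if $(\varepsilon_i,\varepsilon_{i+1})=(-,+)$. Let $\mathbf 1=(+,\dots,+,-,\dots,-)$ ($k$ pluses then $n-k$ minuses). For a Young diagram $\lambda=(\lambda_1\ge\dots\ge\lambda_k\ge0)$, $\lambda_1\le n-k$, with $\ell$ nonzero rows and boxes $(i,j)$, $1\le j\le\lambda_i$: $w_\lambda=P_\ell\cdots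 P_1$ with $P_i=s_{k+\lambda_i-i}s_{k+\lambda_i-i-1}\cdots s_{k+1-i}$; shifts $r_{ij}=\max(r_{i,j+1},r_{i+1,j})+1$ with $r_{ij}=0$ for $(i,j)\notin\lambda$; $[r]=(v^r-v^{ -r})/(v-v^{ -1})$; $X_\lambda=Y_\ell\cdots Y_1$ with $Y_i=\bigl(T_{k+\lambda_i-i}-\tfrac{v^{r_{i,\lambda_i}}}{[r_{i,\lambda_i}]}\bigr)\cdots\bigl(T_{k+1-i}-\tfrac{v^{r_{i,1}}}{[r_{i,1}]}\bigr)$ (factor $T_{k+j-i}-v^{r_{ij}}/[r_{ij}]$ for box $(i,j)$, $j$ decreasing from left to right). -}

module Defs where

open import Data.Nat as ℕ using (ℕ; zero; suc; _∸_; _≤_; _<_)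
open import Data.Bool using (Bool; true; false; if_then_else_)
open import Data.List using (List; []; _∷_; _++_; map; foldr; foldl; upTo; length; replicate; concatMap; filter)
open import Data.List.Relation.Unary.All using (All)
open import Data.List.Relation.Unary.Linked using (Linked)
open import Data.List.Properties using (≡-dec)
open import Data.Maybe using (Maybe; just; nothing)
open import Data.Product using (_×_; _,_; ∃; ∃-syntax; proj₁; proj₂)
open import Data.Rational as ℚ using (ℚ; 0ℚ; 1ℚ)
open import Relation.Binary.PropositionalEquality using (_≡_; _≢_)
open import Relation.Nullary using (¬_; yes; no)
import Data.Bool as B
import Data.Nat as N

-- Polynomials over ℚ in the variable v: coefficient lists, lowest degree
-- first (trailing zeros allowed).

Poly : Set
Poly = List ℚ

padd : Poly → Poly → Poly
padd [] q = q
padd p [] = p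
padd (a ∷ p) (b ∷ q) = (a ℚ.+ b) ∷ padd p q

pscale : ℚ → Poly → Poly
pscale a p = map (a ℚ.*_) p

pmul : Poly → Poly → Poly
pmul [] q = []
pmul (a ∷ p) q = padd (pscale a q) (0ℚ ∷ pmul p q)

pneg : Poly → Poly
pneg = map (λ a → ℚ.- a)

IsZeroP : Poly → Set
IsZeroP p = All (_≡ 0ℚ) p

_≈P_ : Poly → Poly → Set
p ≈P q = IsZeroP (padd p (pneg q))

ev0 : Poly → ℚ
ev0 [] = 0ℚ
ev0 (a ∷ _) = a

pone : Poly
pone = 1ℚ ∷ []

pX : Poly
pX = 0ℚ ∷ 1ℚ ∷ []

pXpow : ℕ → Poly
pXpow zero = pone
pXpow (suc r) = pmul pX (pXpow r)

-- Elements of ℚ(v) as fractions num/den, with equality by cross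
-- multiplication.

record Frac : Set where
  constructor _//_
  field
    num : Poly
    den : Poly
open Frac public

_≈F_ : Frac → Frac → Set
f ≈F g = pmul (num f) (den g) ≈P pmul (num g) (den f)

fzero fone : Frac
fzero = [] // pone
fone = pone // pone

fadd : Frac → Frac → Frac
fadd (a // b) (c // d) = padd (pmul a d) (pmul c b) // pmul b d

fmul : Frac → Frac → Frac
fmul (a // b) (c // d) = pmul a c // pmul b d

fneg : Frac → Frac
fneg (a // b) = pneg a // b

fsub : Frac → Frac → Frac
fsub f g = fadd f (fneg g)

fdiv : Frac → Frac → Frac
fdiv (a // b) (c // d) = pmul a d // pmul b c

fv fvinv : Frac
fv = pX // pone
fvinv = pone // pX

fvpow fvnegpow : ℕ → Frac
fvpow r = pXpow r // pone
fvnegpow r = pone // pXpow r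

qint : ℕ → Frac
qint r = fdiv (fsub (fvpow r) (fvnegpow r)) (fsub fv fvinv)

shiftc : ℕ → Frac
shiftc r = fdiv (fvpow r) (qint r)

-- f ∈ O(v): f is a genuine element of ℚ(v) (nonzero denominator) and
-- v⁻¹ f is regular at 0, i.e. v⁻¹ f = a/b with b(0) ≠ 0.
InO : Frac → Set
InO f = (¬ IsZeroP (den f)) ×
        ∃[ a ] ∃[ b ] ((ev0 b ≢ 0ℚ) × (pmul (num f) b ≈P pmul (pmul pX a) (den f)))

-- Sign sequences: true = '+', false = '-'

Seq : Set
Seq = List Bool

countPlus : Seq → ℕ
countPlus [] = 0
countPlus (true ∷ xs) = suc (countPlus xs)
countPlus (false ∷ xs) = countPlus xs

InE : ℕ → ℕ → Seq → Set
InE n k ε = (length ε ≡ n) × (countPlus ε ≡ k)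

-- s_i (1-indexed): swap positions i and i+1
swapAt : ℕ → Seq → Seq
swapAt (suc zero) (a ∷ b ∷ xs) = b ∷ a ∷ xs
swapAt (suc (suc i)) (x ∷ xs) = x ∷ swapAt (suc i) xs
swapAt _ xs = xs

pairAt : ℕ → Seq → Maybe (Bool × Bool)
pairAt (suc zero) (a ∷ b ∷ xs) = just (a , b)
pairAt (suc (suc i)) (x ∷ xs) = pairAt (suc i) xs
pairAt _ _ = nothing

oneSeq : ℕ → ℕ → Seq
oneSeq n k = replicate k true ++ replicate (n ∸ k) false

-- Elements of M: formal finite linear combinations Σ c_δ δ

Mod : Set
Mod = List (Frac × Seq)

coeff : Mod → Seq → Frac
coeff [] ε = fzero
coeff ((c , δ) ∷ m) ε with ≡-dec B._≟_ δ ε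
... | yes _ = fadd c (coeff m ε)
... | no _ = coeff m ε

basis : Seq → Mod
basis ε = (fone , ε) ∷ []

smul : Frac → Mod → Mod
smul c = map (λ p → fmul c (proj₁ p) , proj₂ p)

Tbasis : ℕ → Seq → Mod
Tbasis i ε with pairAt i ε
... | just (true , false) = (fone , swapAt i ε) ∷ []
... | just (false , true) = (fone , swapAt i ε) ∷ (fsub fv fvinv , ε) ∷ []
... | just (true , true) = (fneg fvinv , ε) ∷ []
... | just (false , false) = (fneg fvinv , ε) ∷ []
... | nothing = (fone , ε) ∷ []

Tact : ℕ → Mod → Mod
Tact i = concatMap (λ p → smul (proj₁ p) (Tbasis i (proj₂ p)))

factorAct : ℕ → Frac → Mod → Mod
factorAct i c m = Tact i m ++ smul (fneg c) m

IsDiagram : ℕ → ℕ → List ℕ → Set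
IsDiagram n k lam = (length lam ≡ k) × Linked (λ a b → b ≤ a) lam × All (_≤ n ∸ k) lam

-- λ_i (1-indexed; 0 outside)
row : List ℕ → ℕ → ℕ
row [] _ = 0
row (x ∷ xs) (suc zero) = x
row (x ∷ xs) (suc (suc i)) = row xs (suc i)
row _ zero = 0

nrows : List ℕ → ℕ
nrows lam = length (filter (λ x → 1 N.≤? x) lam)

boxes : List ℕ → ℕ
boxes = foldr N._+_ 0

inDiag : List ℕ → ℕ → ℕ → Bool
inDiag lam i j = B.not (i N.≡ᵇ 0) B.∧ B.not (j N.≡ᵇ 0) B.∧ (j N.≤ᵇ row lam i)

-- r_ij = max(r_{i,j+1}, r_{i+1,j}) + 1 for (i,j) ∈ λ, 0 otherwise;
-- computed with a fuel argument (fuel ≥ number of boxes suffices, as the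
-- recursion follows a right/down path of distinct boxes).
shiftF : ℕ → List ℕ → ℕ → ℕ → ℕ
shiftF zero lam i j = 0
shiftF (suc f) lam i j =
  if inDiag lam i j then suc (N._⊔_ (shiftF f lam i (suc j)) (shiftF f lam (suc i) j)) else 0

shift : List ℕ → ℕ → ℕ → ℕ
shift lam = shiftF (suc (boxes lam)) lam

-- apply to a list 1..m in increasing order
forUp : {A : Set} → ℕ → (ℕ → A → A) → A → A
forUp m g a = foldl (λ x t → g (suc t) x) a (upTo m)

-- w_λ(ε) = P_ℓ ⋯ P_1 ε, P_i = s_{k+λ_i-i} ⋯ s_{k+1-i}
wAct : ℕ → List ℕ → Seq → Seq
wAct k lam = forUp (nrows lam) (λ i → forUp (row lam i) (λ j → swapAt ((k N.+ j) ∸ i)))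

-- X_λ m = Y_ℓ ⋯ Y_1 m, Y_i = (T_{k+λ_i-i} - v^{r_{i,λ_i}}/[r_{i,λ_i}]) ⋯ (T_{k+1-i} - v^{r_{i1}}/[r_{i1}])
XAct : ℕ → List ℕ → Mod → Mod
XAct k lam = forUp (nrows lam) (λ i → forUp (row lam i)
               (λ j → factorAct ((k N.+ j) ∸ i) (shiftc (shift lam i j))))

{-# OPTIONS --safe #-}
-- Apply the factors of X_λ box by box, row after row. Just before box (i, j) the vector is
-- μ + Σ c_δ δ, where μ is the image of 1 under the transpositions of the boxes already processed;
-- in μ the plus moved by row i sits at p = k + j − i followed by a minus, so T_p μ = s_p μ exactly.
-- Every other coefficient c_δ has v-adic order larger than a potential of δ, a weighted count of
-- the boxes still to be processed that δ is out of place for; the potential of μ is 0. The Hecke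
-- relation for T_p only touches positions p, p + 1 and changes the order of a coefficient by at most
-- the drop of the potential, while v^r/[r] has order 2r − 1 ≥ arm + leg + 1 because r_{ij} exceeds
-- both the arm and the leg of (i, j). Passing to the next row does not increase the potential, so
-- at the end the coefficient of w_λ(1) is 1 + O(v) and all others are O(v).
module Submission where

open import Defs
open import Level using (0ℓ)
open import Function using (_⟨_⟩_)
open import Data.Nat using (ℕ; zero; suc; _+_; _∸_; _≤_; _<_; _≤ᵇ_; _<ᵇ_; _≡ᵇ_; _≤?_; _⊔_; z≤n; s≤s)
import Data.Nat.Properties as ℕ
import Data.Nat.Tactic.RingSolver as ℕ-Ring
open import Data.Bool as Bool using (Bool; true; false; if_then_else_)
open import Data.Maybe using (Maybe; just; nothing)
open import Data.Product using (_×_; Σ; _,_; proj₁; proj₂; ∃₂)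
open import Data.Sum using (inj₁; inj₂)
open import Data.List using (List; []; _∷_; _++_; length; replicate; drop; map; concat; foldl; upTo)
import Data.List.Properties as List
open import Data.List.Relation.Unary.All as All using (All; []; _∷_)
open import Data.List.Relation.Unary.All.Properties using (++⁺; map⁺; concat⁺)
open import Data.List.Relation.Unary.Linked using (Linked; _∷_)
open import Data.Rational as ℚ using (ℚ; 0ℚ; 1ℚ)
import Data.Rational.Properties as ℚ
open import Algebra.Bundles using (CommutativeRing)
open import Relation.Binary using (tri<; tri≈; tri>)
import Relation.Binary.Reasoning.Setoid as SetoidReasoning
open import Relation.Binary.PropositionalEquality using (_≡_; _≢_; refl; sym; trans; cong; cong₂; subst; subst₂; module ≡-Reasoning)
open import Relation.Nullary using (¬_; yes; no; contradiction)
open import Relation.Nullary.Decidable using (dec-true; dec-false)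
open import Tactic.RingSolver using (solve-∀)
open import Tactic.RingSolver.Core.AlmostCommutativeRing using (AlmostCommutativeRing; fromCommutativeRing)

-- Polynomials over ℚ form a commutative ring

pcoeff : Poly → ℕ → ℚ
pcoeff []      _       = 0ℚ
pcoeff (a ∷ p) zero    = a
pcoeff (a ∷ p) (suc i) = pcoeff p i

infix 4 _≋_
record _≋_ (p q : Poly) : Set where
  constructor coeffwise
  field pcoeff-≡ : ∀ i → pcoeff p i ≡ pcoeff q i
open _≋_ public

≋-refl : ∀ {p} → p ≋ p
≋-refl = coeffwise λ _ → refl

≋-sym : ∀ {p q} → p ≋ q → q ≋ p
≋-sym e = coeffwise λ i → sym (pcoeff-≡ e i)

≋-trans : ∀ {p q r} → p ≋ q → q ≋ r → p ≋ r
≋-trans e f = coeffwise λ i → trans (pcoeff-≡ e i) (pcoeff-≡ f i)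

∷-cong : ∀ {a b p q} → a ≡ b → p ≋ q → a ∷ p ≋ b ∷ q
∷-cong a≡b p≋q = coeffwise λ { zero → a≡b ; (suc i) → pcoeff-≡ p≋q i }

pcoeff-padd : ∀ p q i → pcoeff (padd p q) i ≡ pcoeff p i ℚ.+ pcoeff q i
pcoeff-padd []      q       i       = sym (ℚ.+-identityˡ _)
pcoeff-padd (a ∷ p) []      i       = sym (ℚ.+-identityʳ _)
pcoeff-padd (a ∷ p) (b ∷ q) zero    = refl
pcoeff-padd (a ∷ p) (b ∷ q) (suc i) = pcoeff-padd p q i

pcoeff-pneg : ∀ p i → pcoeff (pneg p) i ≡ ℚ.- pcoeff p i
pcoeff-pneg []      i       = refl
pcoeff-pneg (a ∷ p) zero    = refl
pcoeff-pneg (a ∷ p) (suc i) = pcoeff-pneg p i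

pcoeff-pscale : ∀ a p i → pcoeff (pscale a p) i ≡ a ℚ.* pcoeff p i
pcoeff-pscale a []      i       = sym (ℚ.*-zeroʳ a)
pcoeff-pscale a (b ∷ p) zero    = refl
pcoeff-pscale a (b ∷ p) (suc i) = pcoeff-pscale a p i

pcoeff-pmul : ∀ a p q i → pcoeff (pmul (a ∷ p) q) i ≡ a ℚ.* pcoeff q i ℚ.+ pcoeff (0ℚ ∷ pmul p q) i
pcoeff-pmul a p q i = trans (pcoeff-padd (pscale a q) _ i) (cong (ℚ._+ _) (pcoeff-pscale a q i))

padd-cong : ∀ {p p′ q q′} → p ≋ p′ → q ≋ q′ → padd p q ≋ padd p′ q′
padd-cong {p} {p′} {q} {q′} e f = coeffwise λ i → begin
  pcoeff (padd p q) i             ≡⟨ pcoeff-padd p q i ⟩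
  pcoeff p i ℚ.+ pcoeff q i       ≡⟨ cong₂ ℚ._+_ (pcoeff-≡ e i) (pcoeff-≡ f i) ⟩
  pcoeff p′ i ℚ.+ pcoeff q′ i     ≡⟨ pcoeff-padd p′ q′ i ⟨
  pcoeff (padd p′ q′) i           ∎
  where open ≡-Reasoning

pneg-cong : ∀ {p p′} → p ≋ p′ → pneg p ≋ pneg p′
pneg-cong {p} {p′} e = coeffwise λ i →
  trans (pcoeff-pneg p i) (trans (cong ℚ.-_ (pcoeff-≡ e i)) (sym (pcoeff-pneg p′ i)))

padd-comm : ∀ p q → padd p q ≋ padd q p
padd-comm p q = coeffwise λ i →
  trans (pcoeff-padd p q i) (trans (ℚ.+-comm (pcoeff p i) (pcoeff q i)) (sym (pcoeff-padd q p i)))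

padd-assoc : ∀ p q r → padd (padd p q) r ≋ padd p (padd q r)
padd-assoc p q r = coeffwise λ i → begin
  pcoeff (padd (padd p q) r) i                     ≡⟨ pcoeff-padd (padd p q) r i ⟩
  pcoeff (padd p q) i ℚ.+ pcoeff r i               ≡⟨ cong (ℚ._+ pcoeff r i) (pcoeff-padd p q i) ⟩
  pcoeff p i ℚ.+ pcoeff q i ℚ.+ pcoeff r i         ≡⟨ ℚ.+-assoc (pcoeff p i) _ _ ⟩
  pcoeff p i ℚ.+ (pcoeff q i ℚ.+ pcoeff r i)       ≡⟨ cong (pcoeff p i ℚ.+_) (pcoeff-padd q r i) ⟨
  pcoeff p i ℚ.+ pcoeff (padd q r) i               ≡⟨ pcoeff-padd p (padd q r) i ⟨
  pcoeff (padd p (padd q r)) i                     ∎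
  where open ≡-Reasoning

padd-identityʳ : ∀ p → padd p [] ≋ p
padd-identityʳ p = coeffwise λ i → trans (pcoeff-padd p [] i) (ℚ.+-identityʳ _)

padd-inverseʳ : ∀ p → padd p (pneg p) ≋ []
padd-inverseʳ p = coeffwise λ i →
  trans (pcoeff-padd p (pneg p) i) (trans (cong (pcoeff p i ℚ.+_) (pcoeff-pneg p i)) (ℚ.+-inverseʳ (pcoeff p i)))

pscale-cong : ∀ a {p p′} → p ≋ p′ → pscale a p ≋ pscale a p′
pscale-cong a {p} {p′} e = coeffwise λ i →
  trans (pcoeff-pscale a p i) (trans (cong (a ℚ.*_) (pcoeff-≡ e i)) (sym (pcoeff-pscale a p′ i)))

pmul-congʳ : ∀ p {q q′} → q ≋ q′ → pmul p q ≋ pmul p q′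
pmul-congʳ []      e = ≋-refl
pmul-congʳ (a ∷ p) e = padd-cong (pscale-cong a e) (∷-cong refl (pmul-congʳ p e))

0∷-≋[] : ∀ {p} → p ≋ [] → 0ℚ ∷ p ≋ []
0∷-≋[] e = coeffwise λ { zero → refl ; (suc i) → pcoeff-≡ e i }

padd-leftComm : ∀ p q r → padd p (padd q r) ≋ padd q (padd p r)
padd-leftComm p q r = ≋-trans (≋-sym (padd-assoc p q r))
  (≋-trans (padd-cong (padd-comm p q) ≋-refl) (padd-assoc q p r))

pmul-zeroʳ : ∀ p → pmul p [] ≋ []
pmul-zeroʳ []      = ≋-refl
pmul-zeroʳ (a ∷ p) = 0∷-≋[] (pmul-zeroʳ p)

pmul-∷ʳ : ∀ p b q → pmul p (b ∷ q) ≋ padd (pscale b p) (0ℚ ∷ pmul p q)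
pmul-∷ʳ []      b q = ≋-sym (0∷-≋[] ≋-refl)
pmul-∷ʳ (a ∷ p) b q = ∷-cong (cong (ℚ._+ 0ℚ) (ℚ.*-comm a b))
  (≋-trans (padd-cong (≋-refl {pscale a q}) (pmul-∷ʳ p b q)) (padd-leftComm (pscale a q) (pscale b p) (0ℚ ∷ pmul p q)))

pmul-comm : ∀ p q → pmul p q ≋ pmul q p
pmul-comm []      q = ≋-sym (pmul-zeroʳ q)
pmul-comm (a ∷ p) q = ≋-trans (padd-cong (≋-refl {pscale a q}) (∷-cong refl (pmul-comm p q))) (≋-sym (pmul-∷ʳ q a p))

pmul-congˡ : ∀ {p p′} q → p ≋ p′ → pmul p q ≋ pmul p′ q
pmul-congˡ {p} {p′} q e = ≋-trans (pmul-comm p q) (≋-trans (pmul-congʳ q e) (pmul-comm q p′))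

pmul-cong : ∀ {p p′ q q′} → p ≋ p′ → q ≋ q′ → pmul p q ≋ pmul p′ q′
pmul-cong {p′ = p′} {q = q} e f = ≋-trans (pmul-congˡ q e) (pmul-congʳ p′ f)

padd-interchange : ∀ p q r s → padd (padd p q) (padd r s) ≋ padd (padd p r) (padd q s)
padd-interchange p q r s = ≋-trans (padd-assoc p q (padd r s))
  (≋-trans (padd-cong (≋-refl {p}) (padd-leftComm q r s)) (≋-sym (padd-assoc p r (padd q s))))

0∷-padd : ∀ p q → 0ℚ ∷ padd p q ≋ padd (0ℚ ∷ p) (0ℚ ∷ q)
0∷-padd p q = ∷-cong (sym (ℚ.+-identityʳ 0ℚ)) ≋-refl

pscale-distribʳ : ∀ a b p → pscale (a ℚ.+ b) p ≋ padd (pscale a p) (pscale b p)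
pscale-distribʳ a b p = coeffwise λ i → begin
  pcoeff (pscale (a ℚ.+ b) p) i                    ≡⟨ pcoeff-pscale (a ℚ.+ b) p i ⟩
  (a ℚ.+ b) ℚ.* pcoeff p i                         ≡⟨ ℚ.*-distribʳ-+ (pcoeff p i) a b ⟩
  a ℚ.* pcoeff p i ℚ.+ b ℚ.* pcoeff p i            ≡⟨ cong₂ ℚ._+_ (pcoeff-pscale a p i) (pcoeff-pscale b p i) ⟨
  pcoeff (pscale a p) i ℚ.+ pcoeff (pscale b p) i  ≡⟨ pcoeff-padd (pscale a p) (pscale b p) i ⟨
  pcoeff (padd (pscale a p) (pscale b p)) i        ∎
  where open ≡-Reasoning

pscale-distribˡ : ∀ a p q → pscale a (padd p q) ≋ padd (pscale a p) (pscale a q)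
pscale-distribˡ a p q = coeffwise λ i → begin
  pcoeff (pscale a (padd p q)) i                   ≡⟨ pcoeff-pscale a (padd p q) i ⟩
  a ℚ.* pcoeff (padd p q) i                        ≡⟨ cong (a ℚ.*_) (pcoeff-padd p q i) ⟩
  a ℚ.* (pcoeff p i ℚ.+ pcoeff q i)                ≡⟨ ℚ.*-distribˡ-+ a (pcoeff p i) (pcoeff q i) ⟩
  a ℚ.* pcoeff p i ℚ.+ a ℚ.* pcoeff q i            ≡⟨ cong₂ ℚ._+_ (pcoeff-pscale a p i) (pcoeff-pscale a q i) ⟨
  pcoeff (pscale a p) i ℚ.+ pcoeff (pscale a q) i  ≡⟨ pcoeff-padd (pscale a p) (pscale a q) i ⟨
  pcoeff (padd (pscale a p) (pscale a q)) i        ∎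
  where open ≡-Reasoning

pscale-assoc : ∀ a b p → pscale (a ℚ.* b) p ≋ pscale a (pscale b p)
pscale-assoc a b p = coeffwise λ i → begin
  pcoeff (pscale (a ℚ.* b) p) i   ≡⟨ pcoeff-pscale (a ℚ.* b) p i ⟩
  a ℚ.* b ℚ.* pcoeff p i          ≡⟨ ℚ.*-assoc a b (pcoeff p i) ⟩
  a ℚ.* (b ℚ.* pcoeff p i)        ≡⟨ cong (a ℚ.*_) (pcoeff-pscale b p i) ⟨
  a ℚ.* pcoeff (pscale b p) i     ≡⟨ pcoeff-pscale a (pscale b p) i ⟨
  pcoeff (pscale a (pscale b p)) i ∎
  where open ≡-Reasoning

pscale-zero : ∀ p → pscale 0ℚ p ≋ []
pscale-zero p = coeffwise λ i → trans (pcoeff-pscale 0ℚ p i) (ℚ.*-zeroˡ (pcoeff p i))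

pscale-one : ∀ p → pscale 1ℚ p ≋ p
pscale-one p = coeffwise λ i → trans (pcoeff-pscale 1ℚ p i) (ℚ.*-identityˡ (pcoeff p i))

pscale-0∷ : ∀ a p → pscale a (0ℚ ∷ p) ≋ 0ℚ ∷ pscale a p
pscale-0∷ a p = ∷-cong (ℚ.*-zeroʳ a) ≋-refl

pmul-distribʳ : ∀ p q r → pmul (padd p q) r ≋ padd (pmul p r) (pmul q r)
pmul-distribʳ []      q       r = ≋-refl
pmul-distribʳ (a ∷ p) []      r = ≋-sym (padd-identityʳ (pmul (a ∷ p) r))
pmul-distribʳ (a ∷ p) (b ∷ q) r = ≋-trans
  (padd-cong (pscale-distribʳ a b r) (≋-trans (∷-cong refl (pmul-distribʳ p q r)) (0∷-padd (pmul p r) (pmul q r))))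
  (padd-interchange (pscale a r) (pscale b r) (0ℚ ∷ pmul p r) (0ℚ ∷ pmul q r))

pmul-0∷ˡ : ∀ p q → pmul (0ℚ ∷ p) q ≋ 0ℚ ∷ pmul p q
pmul-0∷ˡ p q = padd-cong (pscale-zero q) ≋-refl

pmul-pscaleˡ : ∀ a p q → pmul (pscale a p) q ≋ pscale a (pmul p q)
pmul-pscaleˡ a []      q = ≋-refl
pmul-pscaleˡ a (b ∷ p) q = ≋-trans
  (padd-cong (pscale-assoc a b q) (≋-trans (∷-cong refl (pmul-pscaleˡ a p q)) (≋-sym (pscale-0∷ a (pmul p q)))))
  (≋-sym (pscale-distribˡ a (pscale b q) (0ℚ ∷ pmul p q)))

pmul-assoc : ∀ p q r → pmul (pmul p q) r ≋ pmul p (pmul q r)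
pmul-assoc []      q r = ≋-refl
pmul-assoc (a ∷ p) q r = ≋-trans (pmul-distribʳ (pscale a q) (0ℚ ∷ pmul p q) r)
  (padd-cong (pmul-pscaleˡ a q r) (≋-trans (pmul-0∷ˡ (pmul p q) r) (∷-cong refl (pmul-assoc p q r))))

pmul-identityˡ : ∀ p → pmul pone p ≋ p
pmul-identityˡ p = ≋-trans (padd-cong (pscale-one p) (0∷-≋[] ≋-refl)) (padd-identityʳ p)

pmul-identityʳ : ∀ p → pmul p pone ≋ p
pmul-identityʳ p = ≋-trans (pmul-comm p pone) (pmul-identityˡ p)

pmul-distribˡ : ∀ p q r → pmul p (padd q r) ≋ padd (pmul p q) (pmul p r)
pmul-distribˡ p q r = ≋-trans (pmul-comm p (padd q r))
  (≋-trans (pmul-distribʳ q r p) (padd-cong (pmul-comm q p) (pmul-comm r p)))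

poly-commutativeRing : CommutativeRing 0ℓ 0ℓ
poly-commutativeRing = record
  { Carrier = Poly ; _≈_ = _≋_ ; _+_ = padd ; _*_ = pmul ; -_ = pneg ; 0# = [] ; 1# = pone
  ; isCommutativeRing = record
    { isRing = record
      { +-isAbelianGroup = record
        { isGroup = record
          { isMonoid = record
            { isSemigroup = record
              { isMagma = record
                { isEquivalence = record { refl = ≋-refl ; sym = ≋-sym ; trans = ≋-trans }
                ; ∙-cong = padd-cong }
              ; assoc = padd-assoc }
            ; identity = (λ _ → ≋-refl) , padd-identityʳ }
          ; inverse = (λ p → ≋-trans (padd-comm (pneg p) p) (padd-inverseʳ p)) , padd-inverseʳ
          ; ⁻¹-cong = pneg-cong }
        ; comm = padd-comm }
      ; *-cong = pmul-cong
      ; *-assoc = pmul-assoc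
      ; *-identity = pmul-identityˡ , pmul-identityʳ
      ; distrib = pmul-distribˡ , λ r p q → pmul-distribʳ p q r }
    ; *-comm = pmul-comm } }

≋[]? : ∀ p → Maybe ([] ≋ p)
≋[]? []      = just ≋-refl
≋[]? (a ∷ p) with a ℚ.≟ 0ℚ | ≋[]? p
... | yes a≡0 | just []≋p = just (≋-sym (coeffwise λ { zero → a≡0 ; (suc i) → sym (pcoeff-≡ []≋p i) }))
... | _       | _         = nothing

poly-ring : AlmostCommutativeRing 0ℓ 0ℓ
poly-ring = fromCommutativeRing poly-commutativeRing ≋[]?

module ≋-Reasoning = SetoidReasoning (CommutativeRing.setoid poly-commutativeRing)

-- v-adic orders of fractions

pXpow-+ : ∀ a b → pXpow (a + b) ≋ pmul (pXpow a) (pXpow b)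
pXpow-+ zero    b = ≋-sym (pmul-identityˡ (pXpow b))
pXpow-+ (suc a) b = ≋-trans (pmul-congʳ pX (pXpow-+ a b)) (≋-sym (pmul-assoc pX (pXpow a) (pXpow b)))

pXpow-1 : pXpow 1 ≋ pX
pXpow-1 = pmul-identityʳ pX

ev0≡pcoeff0 : ∀ p → ev0 p ≡ pcoeff p 0
ev0≡pcoeff0 []      = refl
ev0≡pcoeff0 (a ∷ p) = refl

ev0-cong : ∀ {p q} → p ≋ q → ev0 p ≡ ev0 q
ev0-cong {p} {q} e = trans (ev0≡pcoeff0 p) (trans (pcoeff-≡ e 0) (sym (ev0≡pcoeff0 q)))

ev0-pmul : ∀ p q → ev0 (pmul p q) ≡ ev0 p ℚ.* ev0 q
ev0-pmul []      q = sym (ℚ.*-zeroˡ (ev0 q))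
ev0-pmul (a ∷ p) q = begin
  ev0 (pmul (a ∷ p) q)         ≡⟨ ev0≡pcoeff0 (pmul (a ∷ p) q) ⟩
  pcoeff (pmul (a ∷ p) q) 0    ≡⟨ pcoeff-pmul a p q 0 ⟩
  a ℚ.* pcoeff q 0 ℚ.+ 0ℚ      ≡⟨ ℚ.+-identityʳ _ ⟩
  a ℚ.* pcoeff q 0             ≡⟨ cong (a ℚ.*_) (ev0≡pcoeff0 q) ⟨
  a ℚ.* ev0 q                  ∎
  where open ≡-Reasoning

*-≢0 : ∀ {x y : ℚ} → x ≢ 0ℚ → y ≢ 0ℚ → x ℚ.* y ≢ 0ℚ
*-≢0 {x} {y} x≢0 y≢0 xy≡0 = y≢0 (begin
  y                     ≡⟨ ℚ.*-identityˡ y ⟨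
  1ℚ ℚ.* y              ≡⟨ cong (ℚ._* y) (ℚ.*-inverseˡ x) ⟨
  ℚ.1/ x ℚ.* x ℚ.* y    ≡⟨ ℚ.*-assoc (ℚ.1/ x) x y ⟩
  ℚ.1/ x ℚ.* (x ℚ.* y)  ≡⟨ cong (ℚ.1/ x ℚ.*_) xy≡0 ⟩
  ℚ.1/ x ℚ.* 0ℚ         ≡⟨ ℚ.*-zeroʳ (ℚ.1/ x) ⟩
  0ℚ                    ∎)
  where
  open ≡-Reasoning
  instance _ = ℚ.≢-nonZero x≢0

ev0-pmul-≢0 : ∀ p q → ev0 p ≢ 0ℚ → ev0 q ≢ 0ℚ → ev0 (pmul p q) ≢ 0ℚ
ev0-pmul-≢0 p q p≢0 q≢0 e = *-≢0 p≢0 q≢0 (trans (sym (ev0-pmul p q)) e)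

-- f = v^a N / (v^b D) with D(0) ≠ 0, so f has v-adic order at least a − b
record VForm (a b : ℕ) (f : Frac) : Set where
  constructor vform
  field
    numer denom : Poly
    num≋ : num f ≋ pmul (pXpow a) numer
    den≋ : den f ≋ pmul (pXpow b) denom
    ev0-denom≢0 : ev0 denom ≢ 0ℚ
open VForm public

infix 4 _∈O[v^_]
record _∈O[v^_] (f : Frac) (m : ℕ) : Set where
  constructor ∈O
  field
    den-order : ℕ
    form : VForm (den-order + m) den-order f
open _∈O[v^_] public

pmul-pXpow-+ : ∀ a b p → pmul (pmul (pXpow a) (pXpow b)) p ≋ pmul (pXpow (a + b)) p
pmul-pXpow-+ a b p = pmul-congˡ p (≋-sym (pXpow-+ a b))

pmul-interchange : ∀ x y u w → pmul (pmul x u) (pmul y w) ≋ pmul (pmul x y) (pmul u w)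
pmul-interchange = solve-∀ poly-ring

VForm-fmul : ∀ {a b a′ b′ f g} → VForm a b f → VForm a′ b′ g → VForm (a + a′) (b + b′) (fmul f g)
VForm-fmul {a} {b} {a′} {b′} (vform N D n d D≢0) (vform N′ D′ n′ d′ D′≢0) = vform (pmul N N′) (pmul D D′)
  (≋-trans (pmul-cong n n′) (≋-trans (pmul-interchange (pXpow a) (pXpow a′) N N′) (pmul-pXpow-+ a a′ (pmul N N′))))
  (≋-trans (pmul-cong d d′) (≋-trans (pmul-interchange (pXpow b) (pXpow b′) D D′) (pmul-pXpow-+ b b′ (pmul D D′))))
  (ev0-pmul-≢0 D D′ D≢0 D′≢0)

∈O-resp : ∀ {f g m} → num f ≋ num g → den f ≋ den g → f ∈O[v^ m ] → g ∈O[v^ m ]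
∈O-resp n d (∈O b (vform N D n′ d′ D≢0)) = ∈O b (vform N D (≋-trans (≋-sym n) n′) (≋-trans (≋-sym d) d′) D≢0)

∈O-fzero : ∀ {m} → fzero ∈O[v^ m ]
∈O-fzero {m} = ∈O 0 (vform [] pone (≋-sym (pmul-zeroʳ (pXpow m))) (≋-sym (pmul-identityˡ pone)) λ ())

VForm-lower : ∀ {a a′ b f} → a′ ≤ a → VForm a b f → VForm a′ b f
VForm-lower {a} {a′} a′≤a (vform N D n d D≢0) = vform (pmul (pXpow (a ∸ a′)) N) D (≋-trans n split) d D≢0
  where
  open ≋-Reasoning
  split : pmul (pXpow a) N ≋ pmul (pXpow a′) (pmul (pXpow (a ∸ a′)) N)
  split = begin
    pmul (pXpow a) N                                ≡⟨ cong (λ e → pmul (pXpow e) N) (sym (ℕ.m+[n∸m]≡n a′≤a)) ⟩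
    pmul (pXpow (a′ + (a ∸ a′))) N                  ≈⟨ pmul-pXpow-+ a′ (a ∸ a′) N ⟨
    pmul (pmul (pXpow a′) (pXpow (a ∸ a′))) N       ≈⟨ pmul-assoc (pXpow a′) (pXpow (a ∸ a′)) N ⟩
    pmul (pXpow a′) (pmul (pXpow (a ∸ a′)) N)       ∎

∈O-weaken : ∀ {m m′ f} → m′ ≤ m → f ∈O[v^ m ] → f ∈O[v^ m′ ]
∈O-weaken m′≤m (∈O b φ) = ∈O b (VForm-lower (ℕ.+-monoʳ-≤ b m′≤m) φ)

∈O-fadd : ∀ {m f g} → f ∈O[v^ m ] → g ∈O[v^ m ] → fadd f g ∈O[v^ m ]
∈O-fadd {m} {nf // df} {ng // dg} (∈O b (vform N D n d D≢0)) (∈O b′ (vform N′ D′ n′ d′ D′≢0)) =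
  ∈O (b + b′) (vform (padd (pmul N D′) (pmul N′ D)) (pmul D D′) num≋′ den≋′ (ev0-pmul-≢0 D D′ D≢0 D′≢0))
  where
  open ≋-Reasoning
  regroup : ∀ xb xb′ xm N N′ D D′ →
    padd (pmul (pmul (pmul xb xm) N) (pmul xb′ D′)) (pmul (pmul (pmul xb′ xm) N′) (pmul xb D))
      ≋ pmul (pmul (pmul xb xb′) xm) (padd (pmul N D′) (pmul N′ D))
  regroup = solve-∀ poly-ring
  num≋′ : padd (pmul nf dg) (pmul ng df) ≋ pmul (pXpow (b + b′ + m)) (padd (pmul N D′) (pmul N′ D))
  num≋′ = begin
    padd (pmul nf dg) (pmul ng df)
      ≈⟨ padd-cong (pmul-cong (≋-trans n (pmul-congˡ N (pXpow-+ b m))) d′)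
                   (pmul-cong (≋-trans n′ (pmul-congˡ N′ (pXpow-+ b′ m))) d) ⟩
    padd (pmul (pmul (pmul (pXpow b) (pXpow m)) N) (pmul (pXpow b′) D′))
         (pmul (pmul (pmul (pXpow b′) (pXpow m)) N′) (pmul (pXpow b) D))
      ≈⟨ regroup (pXpow b) (pXpow b′) (pXpow m) N N′ D D′ ⟩
    pmul (pmul (pmul (pXpow b) (pXpow b′)) (pXpow m)) (padd (pmul N D′) (pmul N′ D))
      ≈⟨ pmul-congˡ _ (≋-trans (pmul-congˡ (pXpow m) (≋-sym (pXpow-+ b b′))) (≋-sym (pXpow-+ (b + b′) m))) ⟩
    pmul (pXpow (b + b′ + m)) (padd (pmul N D′) (pmul N′ D)) ∎
  den≋′ : pmul df dg ≋ pmul (pXpow (b + b′)) (pmul D D′)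
  den≋′ = ≋-trans (pmul-cong d d′) (≋-trans (pmul-interchange (pXpow b) (pXpow b′) D D′) (pmul-pXpow-+ b b′ (pmul D D′)))

∈O-fneg : ∀ {m f} → f ∈O[v^ m ] → fneg f ∈O[v^ m ]
∈O-fneg {m} (∈O b (vform N D n d D≢0)) = ∈O b (vform (pneg N) D (≋-trans (pneg-cong n) (pneg-pmul (pXpow (b + m)) N)) d D≢0)
  where
  pneg-pmul : ∀ x y → pneg (pmul x y) ≋ pmul x (pneg y)
  pneg-pmul = solve-∀ poly-ring

∈O-fmulˡ : ∀ {a b m m′ c f} → VForm a b c → f ∈O[v^ m ] → m′ + b ≤ m + a → fmul c f ∈O[v^ m′ ]
∈O-fmulˡ {a} {b} {m} {m′} φ (∈O d ψ) m′+b≤m+a = ∈O (b + d) (VForm-lower order (VForm-fmul φ ψ))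
  where
  regroup : ∀ b d m′ → b + d + m′ ≡ d + (m′ + b)
  regroup = ℕ-Ring.solve-∀
  regroup′ : ∀ a d m → d + (m + a) ≡ a + (d + m)
  regroup′ = ℕ-Ring.solve-∀
  order : b + d + m′ ≤ a + (d + m)
  order = subst₂ _≤_ (sym (regroup b d m′)) (regroup′ a d m) (ℕ.+-monoʳ-≤ d m′+b≤m+a)

∈O-fmulʳ : ∀ {a b m m′ c f} → VForm a b c → f ∈O[v^ m ] → m′ + b ≤ m + a → fmul f c ∈O[v^ m′ ]
∈O-fmulʳ {c = nc // dc} {f = nf // df} φ f∈ ineq = ∈O-resp (pmul-comm nc nf) (pmul-comm dc df) (∈O-fmulˡ φ f∈ ineq)

record IsOne (c : Frac) : Set where
  constructor isOne
  field
    num≡den : num c ≡ den c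
    ev0-den≢0 : ev0 (den c) ≢ 0ℚ

IsOne-fone : IsOne fone
IsOne-fone = isOne refl λ ()

IsOne-fmul-fone : ∀ {c} → IsOne c → IsOne (fmul c fone)
IsOne-fmul-fone {c} (isOne n≡d d≢0) = isOne (cong (λ p → pmul p pone) n≡d) (ev0-pmul-≢0 (den c) pone d≢0 λ ())

IsOne⇒VForm : ∀ {c} → IsOne c → VForm 0 0 c
IsOne⇒VForm {c} (isOne n≡d d≢0) = vform (num c) (den c) (≋-sym (pmul-identityˡ (num c))) (≋-sym (pmul-identityˡ (den c))) d≢0

infix 4 _∈1+O[v]
record _∈1+O[v] (f : Frac) : Set where
  constructor ∈1+O
  field minus-one : fsub f fone ∈O[v^ 1 ]

IsOne⇒∈1+O : ∀ {c} → IsOne c → c ∈1+O[v]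
IsOne⇒∈1+O {n // d} (isOne refl d≢0) = ∈1+O (∈O 0 (vform [] d
  (≋-trans (cancel d) (≋-sym (pmul-zeroʳ (pXpow 1))))
  (≋-trans (pmul-identityʳ d) (≋-sym (pmul-identityˡ d))) d≢0))
  where
  cancel : ∀ d → padd (pmul d pone) (pmul (pneg pone) d) ≋ []
  cancel = solve-∀ poly-ring

∈1+O-faddʳ : ∀ {f g} → f ∈1+O[v] → g ∈O[v^ 1 ] → fadd f g ∈1+O[v]
∈1+O-faddʳ {nf // df} {ng // dg} (∈1+O f∈) g∈ = ∈1+O (∈O-resp (numEq nf df ng dg) (denEq df dg) (∈O-fadd f∈ g∈))
  where
  numEq : ∀ nf df ng dg →
    padd (pmul (padd (pmul nf pone) (pmul (pneg pone) df)) dg) (pmul ng (pmul df pone))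
      ≋ padd (pmul (padd (pmul nf dg) (pmul ng df)) pone) (pmul (pneg pone) (pmul df dg))
  numEq = solve-∀ poly-ring
  denEq : ∀ df dg → pmul (pmul df pone) dg ≋ pmul (pmul df dg) pone
  denEq = solve-∀ poly-ring

∈1+O-faddˡ : ∀ {f g} → g ∈O[v^ 1 ] → f ∈1+O[v] → fadd g f ∈1+O[v]
∈1+O-faddˡ {nf // df} {ng // dg} g∈ (∈1+O f∈) = ∈1+O (∈O-resp (numEq nf df ng dg) (denEq df dg) (∈O-fadd f∈ g∈))
  where
  numEq : ∀ nf df ng dg →
    padd (pmul (padd (pmul nf pone) (pmul (pneg pone) df)) dg) (pmul ng (pmul df pone))
      ≋ padd (pmul (padd (pmul ng df) (pmul nf dg)) pone) (pmul (pneg pone) (pmul dg df))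
  numEq = solve-∀ poly-ring
  denEq : ∀ df dg → pmul (pmul df pone) dg ≋ pmul (pmul dg df) pone
  denEq = solve-∀ poly-ring

∈1+O-fsub : ∀ {f g} → f ∈1+O[v] → g ∈1+O[v] → fsub f g ∈O[v^ 1 ]
∈1+O-fsub {nf // df} {ng // dg} (∈1+O f∈) (∈1+O g∈) = ∈O-resp (numEq nf df ng dg) (denEq df dg) (∈O-fadd f∈ (∈O-fneg g∈))
  where
  numEq : ∀ nf df ng dg →
    padd (pmul (padd (pmul nf pone) (pmul (pneg pone) df)) (pmul dg pone))
         (pmul (pneg (padd (pmul ng pone) (pmul (pneg pone) dg))) (pmul df pone))
      ≋ padd (pmul nf dg) (pmul (pneg ng) df)
  numEq = solve-∀ poly-ring
  denEq : ∀ df dg → pmul (pmul df pone) (pmul dg pone) ≋ pmul df dg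
  denEq = solve-∀ poly-ring

VForm-fone : VForm 0 0 fone
VForm-fone = IsOne⇒VForm IsOne-fone

pX≋pXpow1·pone : pX ≋ pmul (pXpow 1) pone
pX≋pXpow1·pone = ≋-sym (≋-trans (pmul-identityʳ (pXpow 1)) pXpow-1)

VForm-fneg-fvinv : VForm 0 1 (fneg fvinv)
VForm-fneg-fvinv = vform (pneg pone) pone (≋-sym (pmul-identityˡ (pneg pone))) pX≋pXpow1·pone λ ()

VForm-fv-fvinv : VForm 0 1 (fsub fv fvinv)
VForm-fv-fvinv = vform (num (fsub fv fvinv)) pone (≋-sym (pmul-identityˡ _)) (≋-trans (pmul-identityˡ pX) pX≋pXpow1·pone) λ ()

ev0-padd : ∀ p q → ev0 (padd p q) ≡ ev0 p ℚ.+ ev0 q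
ev0-padd []      q       = sym (ℚ.+-identityˡ (ev0 q))
ev0-padd (a ∷ p) []      = sym (ℚ.+-identityʳ a)
ev0-padd (a ∷ p) (b ∷ q) = refl

ev0-pXpow-suc : ∀ r → ev0 (pXpow (suc r)) ≡ 0ℚ
ev0-pXpow-suc r = trans (ev0-pmul pX (pXpow r)) (ℚ.*-zeroˡ (ev0 (pXpow r)))

-- v^r/[r] = v^{2r-1}(1 - v²)/(1 - v^{2r}), of exact order 2r - 1
VForm-fneg-shiftc : ∀ {s} → 1 ≤ s → VForm (s + s) 1 (fneg (shiftc s))
VForm-fneg-shiftc {suc r} _ = vform (pneg C) A num≋′ den≋′ ev0-A≢0
  where
  X A C : Poly
  X = pXpow (suc r)
  A = padd (pmul X X) (pmul (pneg pone) pone)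
  C = padd (pmul pX pX) (pmul (pneg pone) pone)
  numShape : ∀ x c → pneg (pmul x (pmul (pmul pone x) c)) ≋ pmul (pmul x x) (pneg c)
  numShape = solve-∀ poly-ring
  denShape : ∀ a x → pmul pone (pmul a (pmul pone x)) ≋ pmul x a
  denShape = solve-∀ poly-ring
  num≋′ : pneg (pmul X (pmul (pmul pone X) C)) ≋ pmul (pXpow (suc r + suc r)) (pneg C)
  num≋′ = ≋-trans (numShape X C) (pmul-pXpow-+ (suc r) (suc r) (pneg C))
  den≋′ : pmul pone (pmul A (pmul pone pX)) ≋ pmul (pXpow 1) A
  den≋′ = ≋-trans (denShape A pX) (pmul-congˡ A (≋-sym pXpow-1))
  ev0-A≢0 : ev0 A ≢ 0ℚ
  ev0-A≢0 ev0-A≡0 = contradiction (trans (sym ev0-A≡-1) ev0-A≡0) λ ()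
    where
    open ≡-Reasoning
    ev0-A≡-1 : ev0 A ≡ ℚ.- 1ℚ
    ev0-A≡-1 = begin
      ev0 A                            ≡⟨ ev0-padd (pmul X X) (pmul (pneg pone) pone) ⟩
      ev0 (pmul X X) ℚ.+ ℚ.- 1ℚ        ≡⟨ cong (ℚ._+ ℚ.- 1ℚ) (ev0-pmul X X) ⟩
      ev0 X ℚ.* ev0 X ℚ.+ ℚ.- 1ℚ       ≡⟨ cong (λ x → x ℚ.* ev0 X ℚ.+ ℚ.- 1ℚ) (ev0-pXpow-suc r) ⟩
      0ℚ ℚ.* ev0 X ℚ.+ ℚ.- 1ℚ          ≡⟨ cong (ℚ._+ ℚ.- 1ℚ) (ℚ.*-zeroˡ (ev0 X)) ⟩
      ℚ.- 1ℚ                           ∎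

IsZeroP⇒≋[] : ∀ {p} → IsZeroP p → p ≋ []
IsZeroP⇒≋[] []      = ≋-refl
IsZeroP⇒≋[] (a≡0 ∷ z) = coeffwise λ { zero → a≡0 ; (suc i) → pcoeff-≡ (IsZeroP⇒≋[] z) i }

≋[]⇒IsZeroP : ∀ p → p ≋ [] → IsZeroP p
≋[]⇒IsZeroP []      _ = []
≋[]⇒IsZeroP (a ∷ p) e = pcoeff-≡ e 0 ∷ ≋[]⇒IsZeroP p (coeffwise λ i → pcoeff-≡ e (suc i))

≋⇒≈P : ∀ {p q} → p ≋ q → p ≈P q
≋⇒≈P {p} {q} e = ≋[]⇒IsZeroP (padd p (pneg q)) (≋-trans (padd-cong e ≋-refl) (padd-inverseʳ q))

pmul-pX : ∀ p → pmul pX p ≋ 0ℚ ∷ p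
pmul-pX p = ≋-trans (pmul-0∷ˡ pone p) (∷-cong refl (pmul-identityˡ p))

pXpow-cancel : ∀ b p → pmul (pXpow b) p ≋ [] → p ≋ []
pXpow-cancel zero    p e = ≋-trans (≋-sym (pmul-identityˡ p)) e
pXpow-cancel (suc b) p e = pXpow-cancel b p (coeffwise λ i → pcoeff-≡ shifted (suc i))
  where
  shifted : 0ℚ ∷ pmul (pXpow b) p ≋ []
  shifted = ≋-trans (≋-sym (pmul-pX _)) (≋-trans (≋-sym (pmul-assoc pX (pXpow b) p)) e)

∈O[v]⇒InO : ∀ {f} → f ∈O[v^ 1 ] → InO f
∈O[v]⇒InO {nf // df} (∈O b (vform N D n d D≢0)) = den≢0 , N , D , D≢0 , ≋⇒≈P cross
  where
  open ≋-Reasoning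
  den≢0 : ¬ IsZeroP df
  den≢0 z = D≢0 (ev0-cong (pXpow-cancel b D (≋-trans (≋-sym d) (IsZeroP⇒≋[] z))))
  regroup : ∀ xb x N D → pmul (pmul (pmul xb x) N) D ≋ pmul (pmul x N) (pmul xb D)
  regroup = solve-∀ poly-ring
  cross : pmul nf D ≋ pmul (pmul pX N) df
  cross = begin
    pmul nf D                               ≈⟨ pmul-congˡ D n ⟩
    pmul (pmul (pXpow (b + 1)) N) D         ≈⟨ pmul-congˡ D (pmul-congˡ N (≋-trans (pXpow-+ b 1) (pmul-congʳ (pXpow b) pXpow-1))) ⟩
    pmul (pmul (pmul (pXpow b) pX) N) D     ≈⟨ regroup (pXpow b) pX N D ⟩
    pmul (pmul pX N) (pmul (pXpow b) D)     ≈⟨ pmul-congʳ (pmul pX N) d ⟨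
    pmul (pmul pX N) df                     ∎

≈F-fadd-fsub : ∀ f g → f ≈F fadd g (fsub f g)
≈F-fadd-fsub (nf // df) (ng // dg) = ≋⇒≈P (cross nf df ng dg)
  where
  cross : ∀ nf df ng dg → pmul nf (pmul dg (pmul df dg))
                         ≋ pmul (padd (pmul ng (pmul df dg)) (pmul (padd (pmul nf dg) (pmul (pneg ng) df)) dg)) df
  cross = solve-∀ poly-ring

-- Sign sequences and sums over positions

-- ε_q, 1-indexed (false outside 1 … length ε)
at : Seq → ℕ → Bool
at (a ∷ ε) 1             = a
at (a ∷ ε) (suc (suc q)) = at ε (suc q)
at _       _             = false

length-swapAt : ∀ p ε → length (swapAt p ε) ≡ length ε
length-swapAt 1             (a ∷ b ∷ ε) = refl
length-swapAt (suc (suc p)) (a ∷ ε)     = cong suc (length-swapAt (suc p) ε)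
length-swapAt 0             ε           = refl
length-swapAt 1             []          = refl
length-swapAt 1             (a ∷ [])    = refl
length-swapAt (suc (suc p)) []          = refl

pairAt≡at : ∀ {p} ε → 1 ≤ p → suc p ≤ length ε → pairAt p ε ≡ just (at ε p , at ε (suc p))
pairAt≡at {1}           (a ∷ b ∷ ε) _ _         = refl
pairAt≡at {suc (suc p)} (a ∷ ε)     _ (s≤s p<) = pairAt≡at ε (s≤s z≤n) p<
pairAt≡at {1}           (a ∷ [])    _ (s≤s ())

at-swapAt-p : ∀ {p} ε → 1 ≤ p → suc p ≤ length ε → at (swapAt p ε) p ≡ at ε (suc p)
at-swapAt-p {1}           (a ∷ b ∷ ε) _ _         = refl
at-swapAt-p {suc (suc p)} (a ∷ ε)     _ (s≤s p<) = at-swapAt-p ε (s≤s z≤n) p<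
at-swapAt-p {1}           (a ∷ [])    _ (s≤s ())

at-swapAt-suc-p : ∀ {p} ε → 1 ≤ p → suc p ≤ length ε → at (swapAt p ε) (suc p) ≡ at ε p
at-swapAt-suc-p {1}           (a ∷ b ∷ ε) _ _         = refl
at-swapAt-suc-p {suc (suc p)} (a ∷ ε)     _ (s≤s p<) = at-swapAt-suc-p ε (s≤s z≤n) p<
at-swapAt-suc-p {1}           (a ∷ [])    _ (s≤s ())

at-swapAt-other : ∀ {p q} ε → q ≢ p → q ≢ suc p → at (swapAt p ε) q ≡ at ε q
at-swapAt-other {1} {1} (a ∷ b ∷ ε) q≢p _     = contradiction refl q≢p
at-swapAt-other {1} {2} (a ∷ b ∷ ε) _   q≢p+1 = contradiction refl q≢p+1
at-swapAt-other {1} {0}                   (a ∷ b ∷ ε) _ _ = refl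
at-swapAt-other {1} {suc (suc (suc q))}   (a ∷ b ∷ ε) _ _ = refl
at-swapAt-other {suc (suc p)} {suc (suc q)} (a ∷ ε) q≢p q≢p+1 =
  at-swapAt-other ε (λ e → q≢p (cong suc e)) (λ e → q≢p+1 (cong suc e))
at-swapAt-other {suc (suc p)} {0} (a ∷ ε) _ _ = refl
at-swapAt-other {suc (suc p)} {1} (a ∷ ε) _ _ = refl
at-swapAt-other {0}           []          _ _ = refl
at-swapAt-other {0}           (a ∷ ε)     _ _ = refl
at-swapAt-other {1}           []          _ _ = refl
at-swapAt-other {1}           (a ∷ [])    _ _ = refl
at-swapAt-other {suc (suc p)} []          _ _ = refl

at-replicate-false : ∀ m q → at (replicate m false) q ≡ false
at-replicate-false (suc m)       1             = refl
at-replicate-false (suc (suc m)) (suc (suc q)) = at-replicate-false (suc m) (suc q)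
at-replicate-false 0             q             = refl
at-replicate-false (suc m)       0             = refl
at-replicate-false 1             (suc (suc q)) = refl

at-++-replicate-≤ : ∀ k m q → 1 ≤ q → q ≤ k → at (replicate k true ++ replicate m false) q ≡ true
at-++-replicate-≤ (suc k)       m 1             _ _         = refl
at-++-replicate-≤ (suc (suc k)) m (suc (suc q)) _ (s≤s q≤k) = at-++-replicate-≤ (suc k) m (suc q) (s≤s z≤n) q≤k

at-++-replicate-> : ∀ k m q → k < q → at (replicate k true ++ replicate m false) q ≡ false
at-++-replicate-> 0             m q             _         = at-replicate-false m q
at-++-replicate-> 1             m 1             (s≤s ())
at-++-replicate-> 1             m (suc (suc q)) _         = at-replicate-false m (suc q)
at-++-replicate-> (suc (suc k)) m (suc (suc q)) (s≤s k<q) = at-++-replicate-> (suc k) m (suc q) k<q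

length-oneSeq : ∀ n k → k ≤ n → length (oneSeq n k) ≡ n
length-oneSeq n k k≤n = trans (List.length-++ (replicate k true))
  (trans (cong₂ _+_ (List.length-replicate k) (List.length-replicate (n ∸ k))) (ℕ.m+[n∸m]≡n k≤n))

sumTo : ℕ → (ℕ → ℕ) → ℕ
sumTo zero    f = 0
sumTo (suc m) f = sumTo m f + f (suc m)

sumTo-cong : ∀ m {f g} → (∀ q → 1 ≤ q → q ≤ m → f q ≡ g q) → sumTo m f ≡ sumTo m g
sumTo-cong zero    f≡g = refl
sumTo-cong (suc m) f≡g =
  cong₂ _+_ (sumTo-cong m λ q 1≤q q≤m → f≡g q 1≤q (ℕ.m≤n⇒m≤1+n q≤m)) (f≡g (suc m) (s≤s z≤n) ℕ.≤-refl)

sumTo-mono-≤ : ∀ m {f g} → (∀ q → 1 ≤ q → q ≤ m → f q ≤ g q) → sumTo m f ≤ sumTo m g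
sumTo-mono-≤ zero    f≤g = z≤n
sumTo-mono-≤ (suc m) f≤g =
  ℕ.+-mono-≤ (sumTo-mono-≤ m λ q 1≤q q≤m → f≤g q 1≤q (ℕ.m≤n⇒m≤1+n q≤m)) (f≤g (suc m) (s≤s z≤n) ℕ.≤-refl)

sumTo-zero : ∀ m {f} → (∀ q → 1 ≤ q → q ≤ m → f q ≡ 0) → sumTo m f ≡ 0
sumTo-zero zero    f≡0 = refl
sumTo-zero (suc m) f≡0 =
  cong₂ _+_ (sumTo-zero m λ q 1≤q q≤m → f≡0 q 1≤q (ℕ.m≤n⇒m≤1+n q≤m)) (f≡0 (suc m) (s≤s z≤n) ℕ.≤-refl)

sumTo-local : ∀ m p {f g} → 1 ≤ p → suc p ≤ m → (∀ q → q ≢ p → q ≢ suc p → f q ≡ g q) →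
              sumTo m f + (g p + g (suc p)) ≡ sumTo m g + (f p + f (suc p))
sumTo-local (suc m) p@(suc p′) {f} {g} 1≤p (s≤s p≤m) f≡g with ℕ.m≤n⇒m<n∨m≡n p≤m
... | inj₁ p<m = begin
  sumTo m f + f (suc m) + (g p + g (suc p))   ≡⟨ cong (λ x → sumTo m f + x + (g p + g (suc p))) f≡g-last ⟩
  sumTo m f + g (suc m) + (g p + g (suc p))   ≡⟨ swap-last (sumTo m f) (g (suc m)) (g p + g (suc p)) ⟩
  sumTo m f + (g p + g (suc p)) + g (suc m)   ≡⟨ cong (_+ g (suc m)) (sumTo-local m p 1≤p p<m f≡g) ⟩
  sumTo m g + (f p + f (suc p)) + g (suc m)   ≡⟨ swap-last (sumTo m g) (f p + f (suc p)) (g (suc m)) ⟩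
  sumTo m g + g (suc m) + (f p + f (suc p))   ∎
  where
  open ≡-Reasoning
  f≡g-last : f (suc m) ≡ g (suc m)
  f≡g-last = f≡g (suc m) (λ e → ℕ.<⇒≢ (ℕ.m<n⇒m<1+n p<m) (sym e)) (λ e → ℕ.<⇒≢ (s≤s p<m) (sym e))
  swap-last : ∀ a b c → a + b + c ≡ a + c + b
  swap-last = ℕ-Ring.solve-∀
... | inj₂ refl = begin
  sumTo p′ f + f p + f (suc p) + (g p + g (suc p))   ≡⟨ cong (λ x → x + f p + f (suc p) + (g p + g (suc p))) f≡g-prefix ⟩
  sumTo p′ g + f p + f (suc p) + (g p + g (suc p))   ≡⟨ exchange (sumTo p′ g) (f p) (f (suc p)) (g p) (g (suc p)) ⟩
  sumTo p′ g + g p + g (suc p) + (f p + f (suc p))   ∎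
  where
  open ≡-Reasoning
  f≡g-prefix : sumTo p′ f ≡ sumTo p′ g
  f≡g-prefix = sumTo-cong p′ λ q _ q≤p′ → f≡g q (ℕ.<⇒≢ (s≤s q≤p′)) (ℕ.<⇒≢ (ℕ.m≤n⇒m≤1+n (s≤s q≤p′)))
  exchange : ∀ s a b c d → s + a + b + (c + d) ≡ s + c + d + (a + b)
  exchange = ℕ-Ring.solve-∀

+-exchange-≤ : ∀ {x y w w′ a b} → x + w ≡ y + w′ → w′ + b ≤ w + a → x + b ≤ y + a
+-exchange-≤ {x} {y} {w} {w′} {a} {b} eq ineq = ℕ.+-cancelʳ-≤ w (x + b) (y + a) (begin
  x + b + w      ≡⟨ regroup x b w ⟩
  x + w + b      ≡⟨ cong (_+ b) eq ⟩
  y + w′ + b     ≡⟨ ℕ.+-assoc y w′ b ⟩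
  y + (w′ + b)   ≤⟨ ℕ.+-monoʳ-≤ y ineq ⟩
  y + (w + a)    ≡⟨ cong (y +_) (ℕ.+-comm w a) ⟩
  y + (a + w)    ≡⟨ ℕ.+-assoc y a w ⟨
  y + a + w      ∎)
  where
  open ℕ.≤-Reasoning
  regroup : ∀ x b w → x + b + w ≡ x + w + b
  regroup = ℕ-Ring.solve-∀

forUp-suc : ∀ {A : Set} m (g : ℕ → A → A) a → forUp (suc m) g a ≡ g (suc m) (forUp m g a)
forUp-suc m g a = trans (cong (foldl (λ x t → g (suc t) x) a) (sym (List.upTo-∷ʳ m)))
                        (List.foldl-∷ʳ (λ x t → g (suc t) x) a m (upTo m))

forUp-ind : ∀ {A B : Set} (I : ℕ → A → B → Set) {g : ℕ → A → A} {h : ℕ → B → B} m {a b} → I 0 a b →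
            (∀ t → t < m → ∀ {x y} → I t x y → I (suc t) (g (suc t) x) (h (suc t) y)) →
            I m (forUp m g a) (forUp m h b)
forUp-ind I         zero    base step = base
forUp-ind I {g} {h} (suc m) {a} {b} base step =
  subst₂ (I (suc m)) (sym (forUp-suc m g a)) (sym (forUp-suc m h b))
    (step m ℕ.≤-refl (forUp-ind I {g} {h} m base λ t t<m → step t (ℕ.m<n⇒m<1+n t<m)))

-- Young diagrams: column lengths and the shifts r_{ij}

row≤boxes : ∀ lam i → row lam i ≤ boxes lam
row≤boxes []        i             = z≤n
row≤boxes (x ∷ lam) 0             = z≤n
row≤boxes (x ∷ lam) 1             = ℕ.m≤m+n x (boxes lam)
row≤boxes (x ∷ lam) (suc (suc i)) = ℕ.≤-trans (row≤boxes lam (suc i)) (ℕ.m≤n+m (boxes lam) x)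

row≤ : ∀ {b} lam → All (_≤ b) lam → ∀ i → row lam i ≤ b
row≤ []        _            i             = z≤n
row≤ (x ∷ lam) _            0             = z≤n
row≤ (x ∷ lam) (x≤b ∷ _)    1             = x≤b
row≤ (x ∷ lam) (_ ∷ lam≤b)  (suc (suc i)) = row≤ lam lam≤b (suc i)

row-antitone : ∀ lam → Linked (λ a b → b ≤ a) lam → ∀ i → 1 ≤ i → row lam (suc i) ≤ row lam i
row-antitone []            _          i             _ = z≤n
row-antitone (x ∷ [])      _          1             _ = z≤n
row-antitone (x ∷ [])      _          (suc (suc i)) _ = z≤n
row-antitone (x ∷ y ∷ lam) (y≤x ∷ _)  1             _ = y≤x
row-antitone (x ∷ y ∷ lam) (_ ∷ link) (suc (suc i)) _ = row-antitone (y ∷ lam) link (suc i) (s≤s z≤n)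

runLength : List ℕ → ℕ → ℕ
runLength []        c = 0
runLength (x ∷ lam) c = if c ≤ᵇ x then suc (runLength lam c) else 0

-- the number of boxes in column c and rows ≥ i (rows and columns are 1-indexed)
colFrom : List ℕ → ℕ → ℕ → ℕ
colFrom lam i zero    = 0
colFrom lam i (suc c) = runLength (drop (i ∸ 1) lam) (suc c)

runLength-drop : ∀ lam i c → runLength (drop i lam) (suc c)
                 ≡ (if suc c ≤ᵇ row lam (suc i) then suc (runLength (drop (suc i) lam) (suc c)) else 0)
runLength-drop []        zero    c = refl
runLength-drop []        (suc i) c = refl
runLength-drop (x ∷ lam) zero    c = refl
runLength-drop (x ∷ lam) (suc i) c = runLength-drop lam i c

colFrom-∈ : ∀ lam i c → 1 ≤ i → 1 ≤ c → c ≤ row lam i → colFrom lam i c ≡ suc (colFrom lam (suc i) c)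
colFrom-∈ lam (suc i) (suc c) _ _ c≤row
  rewrite runLength-drop lam i c | dec-true (suc c ≤? row lam (suc i)) c≤row = refl

colFrom-∉ : ∀ lam i c → 1 ≤ i → row lam i < c → colFrom lam i c ≡ 0
colFrom-∉ lam (suc i) zero    _ _     = refl
colFrom-∉ lam (suc i) (suc c) _ row<c
  rewrite runLength-drop lam i c | dec-false (suc c ≤? row lam (suc i)) (ℕ.<⇒≱ row<c) = refl

runLength≤boxes : ∀ lam c → runLength lam (suc c) ≤ boxes lam
runLength≤boxes []        c = z≤n
runLength≤boxes (x ∷ lam) c with suc c ≤? x
... | yes c<x rewrite dec-true (suc c ≤? x) c<x = ℕ.+-mono-≤ (ℕ.≤-trans (s≤s z≤n) c<x) (runLength≤boxes lam c)
... | no  c≮x rewrite dec-false (suc c ≤? x) c≮x = z≤n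

drop≤boxes : ∀ lam d → boxes (drop d lam) ≤ boxes lam
drop≤boxes lam       zero    = ℕ.≤-refl
drop≤boxes []        (suc d) = z≤n
drop≤boxes (x ∷ lam) (suc d) = ℕ.≤-trans (drop≤boxes lam d) (ℕ.m≤n+m (boxes lam) x)

colFrom≤boxes : ∀ lam i c → colFrom lam i c ≤ boxes lam
colFrom≤boxes lam i zero    = z≤n
colFrom≤boxes lam i (suc c) = ℕ.≤-trans (runLength≤boxes (drop (i ∸ 1) lam) c) (drop≤boxes lam (i ∸ 1))

inDiag-box : ∀ lam i j → 1 ≤ i → 1 ≤ j → j ≤ row lam i → inDiag lam i j ≡ true
inDiag-box lam (suc i) (suc j) _ _ j≤row = dec-true (suc j ≤? row lam (suc i)) j≤row

arm<shiftF : ∀ f lam i j → 1 ≤ i → 1 ≤ j → j ≤ row lam i → row lam i ∸ j < f → row lam i ∸ j < shiftF f lam i j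
arm<shiftF (suc f) lam i j 1≤i 1≤j j≤row arm<f rewrite inDiag-box lam i j 1≤i 1≤j j≤row with ℕ.m≤n⇒m<n∨m≡n j≤row
... | inj₂ refl = s≤s (ℕ.≤-reflexive (ℕ.n∸n≡0 j) ⟨ ℕ.≤-trans ⟩ z≤n)
... | inj₁ j<row = s≤s (begin
  row lam i ∸ j                           ≡⟨ ℕ.+-∸-assoc 1 j<row ⟩
  suc (row lam i ∸ suc j)                 ≤⟨ arm<shiftF f lam i (suc j) 1≤i (s≤s z≤n) j<row arm′<f ⟩
  shiftF f lam i (suc j)                  ≤⟨ ℕ.m≤m⊔n _ _ ⟩
  shiftF f lam i (suc j) ⊔ shiftF f lam (suc i) j ∎)
  where
  open ℕ.≤-Reasoning
  arm′<f : row lam i ∸ suc j < f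
  arm′<f = ℕ.≤-pred (subst (_< suc f) (ℕ.+-∸-assoc 1 j<row) arm<f)

colFrom≤shiftF : ∀ f lam i j → 1 ≤ i → 1 ≤ j → colFrom lam i j ≤ f → colFrom lam i j ≤ shiftF f lam i j
colFrom≤shiftF zero    lam i j _   _   col≤0 = col≤0
colFrom≤shiftF (suc f) lam i j 1≤i 1≤j col≤f with j ≤? row lam i
... | no  j≰row = ℕ.≤-reflexive (colFrom-∉ lam i j 1≤i (ℕ.≰⇒> j≰row)) ⟨ ℕ.≤-trans ⟩ z≤n
... | yes j≤row rewrite inDiag-box lam i j 1≤i 1≤j j≤row | colFrom-∈ lam i j 1≤i 1≤j j≤row =
  s≤s (ℕ.≤-trans (colFrom≤shiftF f lam (suc i) j (s≤s z≤n) 1≤j (ℕ.≤-pred col≤f)) (ℕ.m≤n⊔m _ _))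

arm<shift : ∀ lam i j → 1 ≤ i → 1 ≤ j → j ≤ row lam i → row lam i ∸ j < shift lam i j
arm<shift lam i j 1≤i 1≤j j≤row =
  arm<shiftF (suc (boxes lam)) lam i j 1≤i 1≤j j≤row (s≤s (ℕ.≤-trans (ℕ.m∸n≤m (row lam i) j) (row≤boxes lam i)))

leg<shift : ∀ lam i j → 1 ≤ i → 1 ≤ j → j ≤ row lam i → colFrom lam (suc i) j < shift lam i j
leg<shift lam i j 1≤i 1≤j j≤row = subst (_≤ shift lam i j) (colFrom-∈ lam i j 1≤i 1≤j j≤row)
  (colFrom≤shiftF (suc (boxes lam)) lam i j 1≤i 1≤j (ℕ.m≤n⇒m≤1+n (colFrom≤boxes lam i j)))

hook≤2shift : ∀ lam i j → 1 ≤ i → 1 ≤ j → j ≤ row lam i →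
              row lam i ∸ j + colFrom lam (suc i) j + 2 ≤ shift lam i j + shift lam i j
hook≤2shift lam i j 1≤i 1≤j j≤row = ℕ.≤-trans (ℕ.≤-reflexive (rearrange (row lam i ∸ j) (colFrom lam (suc i) j)))
  (ℕ.+-mono-≤ (arm<shift lam i j 1≤i 1≤j j≤row) (leg<shift lam i j 1≤i 1≤j j≤row))
  where
  rearrange : ∀ a b → a + b + 2 ≡ suc a + suc b
  rearrange = ℕ-Ring.solve-∀

-- The computation of X_λ 1, box by box

Tact-++ : ∀ p xs ys → Tact p (xs ++ ys) ≡ Tact p xs ++ Tact p ys
Tact-++ p xs ys = trans (cong concat (List.map-++ _ xs ys)) (sym (List.concat-++ (map _ xs) (map _ ys)))

if-zero : ∀ s {x} → x ≡ 0 → (if s then x else 0) ≡ 0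
if-zero true  x≡0 = x≡0
if-zero false _   = refl

Coeff∈O[v] : Frac × Seq → Set
Coeff∈O[v] t = proj₁ t ∈O[v^ 1 ]

coeff-∈O : ∀ {m} ε → All Coeff∈O[v] m → coeff m ε ∈O[v^ 1 ]
coeff-∈O ε [] = ∈O-fzero
coeff-∈O {(c , δ) ∷ m} ε (c∈O ∷ rest∈O) with List.≡-dec Bool._≟_ δ ε
... | yes _ = ∈O-fadd c∈O (coeff-∈O ε rest∈O)
... | no  _ = coeff-∈O ε rest∈O

coeff-++ : ∀ (P : Frac → Set) → (∀ {g f} → g ∈O[v^ 1 ] → P f → P (fadd g f)) →
           ∀ {xs ys} ε → All Coeff∈O[v] xs → P (coeff ys ε) → P (coeff (xs ++ ys) ε)
coeff-++ P P-fadd ε [] P-ys = P-ys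
coeff-++ P P-fadd {(c , δ) ∷ xs} ε (c∈O ∷ rest∈O) P-ys with List.≡-dec Bool._≟_ δ ε
... | yes _ = P-fadd c∈O (coeff-++ P P-fadd ε rest∈O P-ys)
... | no  _ = coeff-++ P P-fadd ε rest∈O P-ys

module Construction (n k : ℕ) (lam : List ℕ) (1≤k : 1 ≤ k) (k<n : k < n) (diag : IsDiagram n k lam) where

  rowLen : ℕ → ℕ
  rowLen = row lam

  rowLen≤ : ∀ i → rowLen i ≤ n ∸ k
  rowLen≤ = row≤ lam (proj₂ (proj₂ diag))

  rowLen-antitone : ∀ i → 1 ≤ i → rowLen (suc i) ≤ rowLen i
  rowLen-antitone = row-antitone lam (proj₁ (proj₂ diag))

  col : ℕ → ℕ → ℕ
  col = colFrom lam

  -- The plus that row i moves sits at position pos i j just before box (i, j) is processed.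
  pos : ℕ → ℕ → ℕ
  pos i j = k + j ∸ i

  pos≡ : ∀ {i} j → i ≤ k → pos i j ≡ (k ∸ i) + j
  pos≡ j i≤k = ℕ.+-∸-comm j i≤k

  pos-suc : ∀ {i} j → i ≤ k → pos i (suc j) ≡ suc (pos i j)
  pos-suc j i≤k = trans (pos≡ (suc j) i≤k) (trans (ℕ.+-suc _ j) (cong suc (sym (pos≡ j i≤k))))

  column-pos : ∀ {i} j → i ≤ k → pos i j + i ∸ k ≡ j
  column-pos {i} j i≤k = begin
    pos i j + i ∸ k        ≡⟨ cong (λ x → x + i ∸ k) (pos≡ j i≤k) ⟩
    k ∸ i + j + i ∸ k      ≡⟨ cong (_∸ k) (regroup (k ∸ i) j i) ⟩
    k ∸ i + i + j ∸ k      ≡⟨ cong (λ x → x + j ∸ k) (ℕ.m∸n+n≡m i≤k) ⟩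
    k + j ∸ k              ≡⟨ ℕ.m+n∸m≡n k j ⟩
    j                      ∎
    where
    open ≡-Reasoning
    regroup : ∀ a b c → a + b + c ≡ a + c + b
    regroup = ℕ-Ring.solve-∀

  record Box (i j : ℕ) : Set where
    constructor box
    field
      1≤i : 1 ≤ i
      i≤k : i ≤ k
      1≤j : 1 ≤ j
      j≤row : j ≤ rowLen i

  untouched<pos : ∀ {i} j → i ≤ k → 1 ≤ j → k ∸ i < pos i j
  untouched<pos {i} j i≤k 1≤j =
    subst (k ∸ i <_) (sym (pos≡ j i≤k)) (subst (_≤ k ∸ i + j) (ℕ.+-comm (k ∸ i) 1) (ℕ.+-monoʳ-≤ (k ∸ i) 1≤j))

  pos<n : ∀ {i j} → Box i j → suc (pos i j) ≤ n
  pos<n {i} {j} (box 1≤i i≤k 1≤j j≤row) = begin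
    suc (pos i j)          ≡⟨ cong suc (pos≡ j i≤k) ⟩
    suc (k ∸ i) + j        ≤⟨ ℕ.+-mono-≤ k-i<k (ℕ.≤-trans j≤row (rowLen≤ i)) ⟩
    k + (n ∸ k)            ≡⟨ ℕ.m+[n∸m]≡n (ℕ.<⇒≤ k<n) ⟩
    n                      ∎
    where
    open ℕ.≤-Reasoning
    k-i<k : k ∸ i < k
    k-i<k = ℕ.∸-monoʳ-< 1≤i i≤k

  column-untouched : ∀ {i q} → i ≤ k → q ≤ k ∸ i → q + i ∸ k ≡ 0
  column-untouched {i} {q} i≤k q≤ = ℕ.m≤n⇒m∸n≡0 (begin
    q + i       ≤⟨ ℕ.+-monoˡ-≤ i q≤ ⟩
    k ∸ i + i   ≡⟨ ℕ.m∸n+n≡m i≤k ⟩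
    k           ∎)
    where open ℕ.≤-Reasoning

  column-> : ∀ {i c q} → i ≤ k → pos i c < q → c ≤ q + i ∸ suc k
  column-> {i} {c} {suc q} i≤k (s≤s p≤q) = begin
    c                        ≡⟨ column-pos c i≤k ⟨
    pos i c + i ∸ k          ≤⟨ ℕ.∸-monoˡ-≤ k (ℕ.+-monoˡ-≤ i p≤q) ⟩
    q + i ∸ k                ∎
    where open ℕ.≤-Reasoning

  -- Just before box (i, j), every term δ other than the main one has a coefficient of v-adic order
  -- > potential i j δ. A plus at a position q ≠ pos i j weighs the number of unprocessed boxes in the
  -- column it would have to cross, a minus at pos i j the number of unprocessed boxes of row i.
  weight : ℕ → ℕ → ℕ → Bool → ℕ
  weight i j q s =
    if q <ᵇ pos i j      then (if s then col (suc i) (q + i ∸ k) else 0)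
    else if q ≡ᵇ pos i j then (if s then 0 else suc (rowLen i) ∸ j)
    else                      (if s then col i (q + i ∸ suc k) else 0)

  potential : ℕ → ℕ → Seq → ℕ
  potential i j ε = sumTo n λ q → weight i j q (at ε q)

  weight-< : ∀ i j {q} s → q < pos i j → weight i j q s ≡ (if s then col (suc i) (q + i ∸ k) else 0)
  weight-< i j {q} s q<p rewrite dec-true (q ℕ.<? pos i j) q<p = refl

  weight-≡ : ∀ i j s → weight i j (pos i j) s ≡ (if s then 0 else suc (rowLen i) ∸ j)
  weight-≡ i j s rewrite dec-false (pos i j ℕ.<? pos i j) (ℕ.n≮n _) | dec-true (pos i j ℕ.≟ pos i j) refl = refl

  weight-> : ∀ i j {q} s → pos i j < q → weight i j q s ≡ (if s then col i (q + i ∸ suc k) else 0)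
  weight-> i j {q} s p<q rewrite dec-false (q ℕ.<? pos i j) (ℕ.<⇒≯ p<q) | dec-false (q ℕ.≟ pos i j) (ℕ.>⇒≢ p<q) = refl

  Untouched : ℕ → Seq → Set
  Untouched i ε = ∀ q → 1 ≤ q → q ≤ k ∸ i → at ε q ≡ true

  record Good (i j : ℕ) (t : Frac × Seq) : Set where
    constructor good
    field
      length≡n    : length (proj₂ t) ≡ n
      untouched   : Untouched i (proj₂ t)
      coeff-order : proj₁ t ∈O[v^ suc (potential i j (proj₂ t)) ]
  open Good public

  -- μ is the image of 1 under the transpositions of the boxes preceding (i, j)
  record IsMain (i j : ℕ) (μ : Seq) : Set where
    constructor isMain
    field
      main-length    : length μ ≡ n
      main-plus      : at μ (pos i j) ≡ true
      main-before    : ∀ q → q < pos i j → at μ q ≡ true → q ≤ k ∸ i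
      main-after     : ∀ q → pos i j < q → q ≤ pos i (suc (rowLen i)) → at μ q ≡ false
      main-untouched : Untouched i μ
  open IsMain public

  record Inv (i j : ℕ) (μ : Seq) (m : Mod) : Set where
    constructor inv
    field
      before after : Mod
      c₁           : Frac
      split        : m ≡ before ++ (c₁ , μ) ∷ after
      c₁-isOne     : IsOne c₁
      good-before  : All (Good i j) before
      good-after   : All (Good i j) after
      main         : IsMain i j μ

  module AtBox {i j : ℕ} (bx : Box i j) where
    open Box bx

    p arm leg : ℕ
    p   = pos i j
    arm = rowLen i ∸ j
    leg = col (suc i) j

    pos-next : pos i (suc j) ≡ suc p
    pos-next = pos-suc j i≤k

    weight-p : ∀ s → weight i j p s ≡ (if s then 0 else suc arm)
    weight-p s = trans (weight-≡ i j s) (cong (if s then 0 else_) (ℕ.+-∸-assoc 1 j≤row))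

    weight-suc-p : ∀ s → weight i j (suc p) s ≡ (if s then suc leg else 0)
    weight-suc-p s = trans (weight-> i j s (ℕ.n<1+n p))
      (cong (λ c → if s then c else 0) (trans (cong (col i) (column-pos j i≤k)) (colFrom-∈ lam i j 1≤i 1≤j j≤row)))

    weight-next-p : ∀ s → weight i (suc j) p s ≡ (if s then leg else 0)
    weight-next-p s = trans (weight-< i (suc j) s (subst (p <_) (sym pos-next) (ℕ.n<1+n p)))
      (cong (λ c → if s then col (suc i) c else 0) (column-pos j i≤k))

    weight-next-suc-p : ∀ s → weight i (suc j) (suc p) s ≡ (if s then 0 else arm)
    weight-next-suc-p s = subst (λ q → weight i (suc j) q s ≡ (if s then 0 else arm)) pos-next (weight-≡ i (suc j) s)

    weight-next-other : ∀ {q} s → q ≢ p → q ≢ suc p → weight i (suc j) q s ≡ weight i j q s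
    weight-next-other {q} s q≢p q≢p+1 with q ℕ.<? p
    ... | yes q<p = trans (weight-< i (suc j) s (subst (q <_) (sym pos-next) (ℕ.m<n⇒m<1+n q<p))) (sym (weight-< i j s q<p))
    ... | no  q≮p = trans (weight-> i (suc j) s (subst (_< q) (sym pos-next) p+1<q)) (sym (weight-> i j s p<q))
      where
      p<q : p < q
      p<q = ℕ.≤∧≢⇒< (ℕ.≮⇒≥ q≮p) (λ e → q≢p (sym e))
      p+1<q : suc p < q
      p+1<q = ℕ.≤∧≢⇒< p<q (λ e → q≢p+1 (sym e))

    1≤p : 1 ≤ p
    1≤p = ℕ.≤-trans (s≤s z≤n) (untouched<pos j i≤k 1≤j)

    untouched≢ : ∀ {q} → q ≤ k ∸ i → q ≢ p × q ≢ suc p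
    untouched≢ {q} q≤ = (λ q≡p → ℕ.<⇒≢ q<p q≡p) , (λ q≡p+1 → ℕ.<⇒≢ (ℕ.m<n⇒m<1+n q<p) q≡p+1)
      where
      q<p : q < p
      q<p = ℕ.≤-<-trans q≤ (untouched<pos j i≤k 1≤j)

    AgreeOff : Seq → Seq → Set
    AgreeOff ε′ ε = ∀ q → q ≢ p → q ≢ suc p → at ε′ q ≡ at ε q

    Untouched-agree : ∀ ε ε′ → AgreeOff ε′ ε → Untouched i ε → Untouched i ε′
    Untouched-agree ε ε′ agree unt q 1≤q q≤ = trans (agree q (proj₁ (untouched≢ q≤)) (proj₂ (untouched≢ q≤))) (unt q 1≤q q≤)

    oldLocal newLocal : Bool → Bool → ℕ
    oldLocal s₁ s₂ = (if s₁ then 0 else suc arm) + (if s₂ then suc leg else 0)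
    newLocal s₁ s₂ = (if s₁ then leg else 0) + (if s₂ then 0 else arm)

    potential-local : ∀ ε ε′ → AgreeOff ε′ ε →
      potential i (suc j) ε′ + oldLocal (at ε p) (at ε (suc p)) ≡ potential i j ε + newLocal (at ε′ p) (at ε′ (suc p))
    potential-local ε ε′ agree = begin
      potential i (suc j) ε′ + oldLocal (at ε p) (at ε (suc p))
        ≡⟨ cong (potential i (suc j) ε′ +_) (sym (cong₂ _+_ (weight-p (at ε p)) (weight-suc-p (at ε (suc p))))) ⟩
      potential i (suc j) ε′ + (weight i j p (at ε p) + weight i j (suc p) (at ε (suc p)))
        ≡⟨ sumTo-local n p 1≤p (pos<n bx) weights-agree ⟩
      potential i j ε + (weight i (suc j) p (at ε′ p) + weight i (suc j) (suc p) (at ε′ (suc p)))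
        ≡⟨ cong (potential i j ε +_) (cong₂ _+_ (weight-next-p (at ε′ p)) (weight-next-suc-p (at ε′ (suc p)))) ⟩
      potential i j ε + newLocal (at ε′ p) (at ε′ (suc p)) ∎
      where
      open ≡-Reasoning
      weights-agree : ∀ q → q ≢ p → q ≢ suc p → weight i (suc j) q (at ε′ q) ≡ weight i j q (at ε q)
      weights-agree q q≢p q≢p+1 = trans (cong (weight i (suc j) q) (agree q q≢p q≢p+1)) (weight-next-other (at ε q) q≢p q≢p+1)

    newLocal≤ : ∀ s₁ s₂ → newLocal s₁ s₂ ≤ leg + arm
    newLocal≤ s₁ s₂ = ℕ.+-mono-≤ (bound₁ s₁) (bound₂ s₂)
      where
      bound₁ : ∀ s → (if s then leg else 0) ≤ leg
      bound₁ true  = ℕ.≤-refl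
      bound₁ false = z≤n
      bound₂ : ∀ s → (if s then 0 else arm) ≤ arm
      bound₂ true  = z≤n
      bound₂ false = ℕ.≤-refl

    potential-next≤ : ∀ ε → potential i (suc j) ε ≤ potential i j ε + (leg + arm)
    potential-next≤ ε = begin
      potential i (suc j) ε                                       ≤⟨ ℕ.m≤m+n _ _ ⟩
      potential i (suc j) ε + oldLocal (at ε p) (at ε (suc p))    ≡⟨ potential-local ε ε (λ _ _ _ → refl) ⟩
      potential i j ε + newLocal (at ε p) (at ε (suc p))          ≤⟨ ℕ.+-monoʳ-≤ (potential i j ε) (newLocal≤ (at ε p) (at ε (suc p))) ⟩
      potential i j ε + (leg + arm)                               ∎
      where open ℕ.≤-Reasoning

    Good-factor : ∀ {c φ a b ε ε′} → Good i j (c , ε) → length ε′ ≡ n → AgreeOff ε′ ε → VForm a b φ →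
                  newLocal (at ε′ p) (at ε′ (suc p)) + b ≤ oldLocal (at ε p) (at ε (suc p)) + a →
                  Good i (suc j) (fmul c φ , ε′)
    Good-factor {a = a} {b} {ε} {ε′} (good _ unt c∈O) len agree φ local =
      good len (Untouched-agree ε ε′ agree unt) (∈O-fmulʳ φ c∈O (s≤s order))
      where
      order : potential i (suc j) ε′ + b ≤ potential i j ε + a
      order = +-exchange-≤ {potential i (suc j) ε′} {potential i j ε} {a = a} {b} (potential-local ε ε′ agree) local

    Good-stay : ∀ {c φ a b ε s₁ s₂} → Good i j (c , ε) → VForm a b φ → at ε p ≡ s₁ → at ε (suc p) ≡ s₂ →
                newLocal s₁ s₂ + b ≤ oldLocal s₁ s₂ + a → Good i (suc j) (fmul c φ , ε)
    Good-stay {a = a} {b} {ε} g φ e₁ e₂ local = Good-factor {ε′ = ε} g (length≡n g) (λ _ _ _ → refl) φ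
      (subst₂ (λ s₁ s₂ → newLocal s₁ s₂ + b ≤ oldLocal s₁ s₂ + a) (sym e₁) (sym e₂) local)

    p<length : ∀ (ε : Seq) → length ε ≡ n → suc p ≤ length ε
    p<length ε len = subst (suc p ≤_) (sym len) (pos<n bx)

    Good-swap : ∀ {c φ a b ε s₁ s₂} → Good i j (c , ε) → VForm a b φ → at ε p ≡ s₁ → at ε (suc p) ≡ s₂ →
                newLocal s₂ s₁ + b ≤ oldLocal s₁ s₂ + a → Good i (suc j) (fmul c φ , swapAt p ε)
    Good-swap {a = a} {b} {ε} g φ e₁ e₂ local =
      Good-factor g (trans (length-swapAt p ε) (length≡n g)) (λ q → at-swapAt-other {p} {q} ε) φ
        (subst₂ (λ s₁′ s₂′ → newLocal s₁′ s₂′ + b ≤ oldLocal (at ε p) (at ε (suc p)) + a)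
                (sym (at-swapAt-p ε 1≤p (p<length ε (length≡n g)))) (sym (at-swapAt-suc-p ε 1≤p (p<length ε (length≡n g))))
                (subst₂ (λ s₁ s₂ → newLocal s₂ s₁ + b ≤ oldLocal s₁ s₂ + a) (sym e₁) (sym e₂) local))

    Good-Tbasis : ∀ {c ε} → Good i j (c , ε) → All (Good i (suc j)) (smul c (Tbasis p ε))
    Good-Tbasis {c} {ε} g rewrite pairAt≡at ε 1≤p (p<length ε (length≡n g)) with at ε p in e₁ | at ε (suc p) in e₂
    ... | true  | false = Good-swap g VForm-fone e₁ e₂ ℕ.≤-refl ∷ []
    ... | false | true  = Good-swap g VForm-fone e₁ e₂ two-fewer ∷ Good-stay g VForm-fv-fvinv e₁ e₂ (s≤s z≤n) ∷ []
      where
      two-fewer : leg + arm + 0 ≤ suc arm + suc leg + 0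
      two-fewer = ℕ.≤-trans (ℕ.m≤m+n (leg + arm + 0) 2) (ℕ.≤-reflexive (regroup leg arm))
        where
        regroup : ∀ l a → l + a + 0 + 2 ≡ suc a + suc l + 0
        regroup = ℕ-Ring.solve-∀
    ... | true  | true  = Good-stay g VForm-fneg-fvinv e₁ e₂ (ℕ.≤-reflexive (one-fewer leg)) ∷ []
      where
      one-fewer : ∀ l → l + 0 + 1 ≡ 0 + suc l + 0
      one-fewer = ℕ-Ring.solve-∀
    ... | false | false = Good-stay g VForm-fneg-fvinv e₁ e₂ (ℕ.≤-reflexive (one-fewer′ arm)) ∷ []
      where
      one-fewer′ : ∀ a → 0 + a + 1 ≡ suc a + 0 + 0
      one-fewer′ = ℕ-Ring.solve-∀

    scalar : Frac
    scalar = shiftc (shift lam i j)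

    VForm-scalar : VForm (shift lam i j + shift lam i j) 1 (fneg scalar)
    VForm-scalar = VForm-fneg-shiftc (ℕ.≤-trans (s≤s z≤n) (arm<shift lam i j 1≤i 1≤j j≤row))

    potential-scalar : ∀ ε → suc (potential i (suc j) ε) + 1 ≤ potential i j ε + (shift lam i j + shift lam i j)
    potential-scalar ε = begin
      suc (potential i (suc j) ε) + 1     ≡⟨ ℕ.+-comm (suc (potential i (suc j) ε)) 1 ⟩
      2 + potential i (suc j) ε           ≤⟨ ℕ.+-monoʳ-≤ 2 (potential-next≤ ε) ⟩
      2 + (potential i j ε + (leg + arm)) ≡⟨ regroup (potential i j ε) leg arm ⟩
      potential i j ε + (arm + leg + 2)   ≤⟨ ℕ.+-monoʳ-≤ (potential i j ε) (hook≤2shift lam i j 1≤i 1≤j j≤row) ⟩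
      potential i j ε + (shift lam i j + shift lam i j) ∎
      where
      open ℕ.≤-Reasoning
      regroup : ∀ x l a → 2 + (x + (l + a)) ≡ x + (a + l + 2)
      regroup = ℕ-Ring.solve-∀

    Good-scalar : ∀ {c ε} → Good i j (c , ε) → Good i (suc j) (fmul (fneg scalar) c , ε)
    Good-scalar {ε = ε} (good len unt c∈O) =
      good len unt (∈O-fmulˡ VForm-scalar c∈O (ℕ.≤-trans (potential-scalar ε) (ℕ.+-monoˡ-≤ _ (ℕ.n≤1+n (potential i j ε)))))

    main-suc-p : ∀ {μ} → IsMain i j μ → at μ (suc p) ≡ false
    main-suc-p mi = main-after mi (suc p) (ℕ.n<1+n p)
      (subst (_≤ pos i (suc (rowLen i))) pos-next (ℕ.∸-monoˡ-≤ i (ℕ.+-monoʳ-≤ k (s≤s j≤row))))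

    potential-main : ∀ {μ} → IsMain i j μ → potential i j μ ≡ 0
    potential-main {μ} mi = sumTo-zero n λ q _ _ → weight-main q
      where
      weight-main : ∀ q → weight i j q (at μ q) ≡ 0
      weight-main q with ℕ.<-cmp q p | at μ q in μq
      ... | tri< q<p _ _  | true  = trans (weight-< i j true q<p) (cong (col (suc i)) (column-untouched i≤k (main-before mi q q<p μq)))
      ... | tri< q<p _ _  | false = weight-< i j false q<p
      ... | tri≈ _ refl _ | true  = weight-≡ i j true
      ... | tri≈ _ refl _ | false = contradiction (trans (sym μq) (main-plus mi)) λ ()
      ... | tri> _ _ p<q  | false = weight-> i j false p<q
      ... | tri> _ _ p<q  | true with q ≤? pos i (suc (rowLen i))
      ...   | yes q≤ = contradiction (trans (sym μq) (main-after mi q p<q q≤)) λ ()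
      ...   | no  q≰ = trans (weight-> i j true p<q) (colFrom-∉ lam i (q + i ∸ suc k) 1≤i (column-> i≤k (ℕ.≰⇒> q≰)))

    IsMain-next : ∀ {μ} → IsMain i j μ → IsMain i (suc j) (swapAt p μ)
    IsMain-next {μ} mi = isMain
      (trans (length-swapAt p μ) (main-length mi))
      (subst (λ q → at (swapAt p μ) q ≡ true) (sym pos-next) (trans (at-swapAt-suc-p μ 1≤p p<len) (main-plus mi)))
      before after
      (Untouched-agree μ (swapAt p μ) (λ q → at-swapAt-other {p} {q} μ) (main-untouched mi))
      where
      p<len : suc p ≤ length μ
      p<len = p<length μ (main-length mi)
      before : ∀ q → q < pos i (suc j) → at (swapAt p μ) q ≡ true → q ≤ k ∸ i
      before q q<p+1 μ′q with ℕ.m≤n⇒m<n∨m≡n (ℕ.≤-pred (subst (q <_) pos-next q<p+1))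
      ... | inj₁ q<p  = main-before mi q q<p (trans (sym (at-swapAt-other μ (ℕ.<⇒≢ q<p) (ℕ.<⇒≢ (ℕ.m<n⇒m<1+n q<p)))) μ′q)
      ... | inj₂ refl = contradiction (trans (sym μ′q) (trans (at-swapAt-p μ 1≤p p<len) (main-suc-p mi))) λ ()
      after : ∀ q → pos i (suc j) < q → q ≤ pos i (suc (rowLen i)) → at (swapAt p μ) q ≡ false
      after q p+1<q q≤ = trans (at-swapAt-other μ (ℕ.>⇒≢ p<q) (ℕ.>⇒≢ p+1<q′)) (main-after mi q p<q q≤)
        where
        p+1<q′ : suc p < q
        p+1<q′ = subst (_< q) pos-next p+1<q
        p<q : p < q
        p<q = ℕ.<-trans (ℕ.n<1+n p) p+1<q′

    Tbasis-main : ∀ {μ} → IsMain i j μ → Tbasis p μ ≡ (fone , swapAt p μ) ∷ []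
    Tbasis-main {μ} mi rewrite pairAt≡at μ 1≤p (p<length μ (main-length mi)) | main-plus mi | main-suc-p mi = refl

    Good-main-scalar : ∀ {c μ} → IsMain i j μ → IsOne c → Good i (suc j) (fmul (fneg scalar) c , μ)
    Good-main-scalar {μ = μ} mi one = good (main-length mi) (main-untouched mi)
      (∈O-fmulˡ VForm-scalar (∈O 0 (IsOne⇒VForm one)) order)
      where
      order : suc (potential i (suc j) μ) + 1 ≤ 0 + (shift lam i j + shift lam i j)
      order = subst (λ x → suc (potential i (suc j) μ) + 1 ≤ x + _) (potential-main mi) (potential-scalar μ)

    Inv-step : ∀ {μ m} → Inv i j μ m → Inv i (suc j) (swapAt p μ) (factorAct p scalar m)
    Inv-step {μ} (inv before after c refl one good-before good-after mi) =
      inv (Tact p before) (Tact p after ++ scaled) (fmul c fone) split′ (IsOne-fmul-fone one)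
          (All-Tact good-before) (++⁺ (All-Tact good-after) good-scaled) (IsMain-next mi)
      where
      scaled : Mod
      scaled = smul (fneg scalar) (before ++ (c , μ) ∷ after)
      All-Tact : ∀ {m} → All (Good i j) m → All (Good i (suc j)) (Tact p m)
      All-Tact gs = concat⁺ (map⁺ (All.map Good-Tbasis gs))
      good-scaled : All (Good i (suc j)) scaled
      good-scaled = map⁺ (++⁺ (All.map Good-scalar good-before) (Good-main-scalar mi one ∷ All.map Good-scalar good-after))
      split′ : Tact p (before ++ (c , μ) ∷ after) ++ scaled ≡ Tact p before ++ (fmul c fone , swapAt p μ) ∷ Tact p after ++ scaled
      split′ = begin
        Tact p (before ++ (c , μ) ∷ after) ++ scaled                          ≡⟨ cong (_++ scaled) (Tact-++ p before ((c , μ) ∷ after)) ⟩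
        (Tact p before ++ smul c (Tbasis p μ) ++ Tact p after) ++ scaled      ≡⟨ List.++-assoc (Tact p before) _ scaled ⟩
        Tact p before ++ (smul c (Tbasis p μ) ++ Tact p after) ++ scaled
          ≡⟨ cong (λ t → Tact p before ++ (smul c t ++ Tact p after) ++ scaled) (Tbasis-main mi) ⟩
        Tact p before ++ (fmul c fone , swapAt p μ) ∷ Tact p after ++ scaled  ∎
        where open ≡-Reasoning

  module NextRow {i : ℕ} (1≤i : 1 ≤ i) (i<k : suc i ≤ k) where
    i≤k : i ≤ k
    i≤k = ℕ.<⇒≤ i<k

    P : ℕ
    P = pos i (suc (rowLen i))

    k∸i≡ : k ∸ i ≡ suc (k ∸ suc i)
    k∸i≡ = ℕ.+-∸-assoc 1 i<k

    pos-first : pos (suc i) 1 ≡ k ∸ i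
    pos-first = trans (pos≡ 1 i<k) (trans (ℕ.+-comm (k ∸ suc i) 1) (sym k∸i≡))

    Untouched-next : ∀ δ → Untouched i δ → Untouched (suc i) δ
    Untouched-next δ unt q 1≤q q≤ = unt q 1≤q (ℕ.≤-trans q≤ (ℕ.∸-monoʳ-≤ k (ℕ.n≤1+n i)))

    untouched-last : ∀ δ → Untouched i δ → at δ (k ∸ i) ≡ true
    untouched-last δ unt = unt (k ∸ i) (subst (1 ≤_) (sym k∸i≡) (s≤s z≤n)) ℕ.≤-refl

    next-end<P : pos (suc i) (suc (rowLen (suc i))) < P
    next-end<P = begin-strict
      pos (suc i) (suc (rowLen (suc i)))   ≡⟨ pos≡ (suc (rowLen (suc i))) i<k ⟩
      k ∸ suc i + suc (rowLen (suc i))     ≡⟨ ℕ.+-suc (k ∸ suc i) (rowLen (suc i)) ⟩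
      suc (k ∸ suc i) + rowLen (suc i)     ≡⟨ cong (_+ rowLen (suc i)) k∸i≡ ⟨
      k ∸ i + rowLen (suc i)               <⟨ ℕ.+-monoʳ-< (k ∸ i) (s≤s (rowLen-antitone i 1≤i)) ⟩
      k ∸ i + suc (rowLen i)               ≡⟨ pos≡ (suc (rowLen i)) i≤k ⟨
      P                                    ∎
      where open ℕ.≤-Reasoning

    IsMain-nextRow : ∀ {μ} → IsMain i (suc (rowLen i)) μ → IsMain (suc i) 1 μ
    IsMain-nextRow {μ} mi = isMain (main-length mi)
      (subst (λ q → at μ q ≡ true) (sym pos-first) (untouched-last μ (main-untouched mi)))
      (λ q q<p _ → ℕ.≤-pred (subst (q <_) (trans pos-first k∸i≡) q<p))
      after
      (Untouched-next μ (main-untouched mi))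
      where
      after : ∀ q → pos (suc i) 1 < q → q ≤ pos (suc i) (suc (rowLen (suc i))) → at μ q ≡ false
      after q p<q q≤ with at μ q in μq
      ... | false = refl
      ... | true  = contradiction (main-before mi q (ℕ.≤-<-trans q≤ next-end<P) μq) (ℕ.<⇒≱ (subst (_< q) pos-first p<q))

    col-beyond : ∀ {c} → suc (rowLen i) ≤ c → col (suc i) c ≡ 0
    col-beyond c≥ = colFrom-∉ lam (suc i) _ (s≤s z≤n) (ℕ.<-≤-trans (s≤s (rowLen-antitone i 1≤i)) c≥)

    plus-weight≤ : ∀ q s →
                   (if s then col (suc i) (q + i ∸ k) else 0) ≤ weight i (suc (rowLen i)) q s
    plus-weight≤ q false = z≤n
    plus-weight≤ q true with q ℕ.<? P
    ... | yes q<P = ℕ.≤-reflexive (sym (weight-< i (suc (rowLen i)) true q<P))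
    ... | no  q≮P = ℕ.≤-reflexive (col-beyond column≥) ⟨ ℕ.≤-trans ⟩ z≤n
      where
      column≥ : suc (rowLen i) ≤ q + i ∸ k
      column≥ = subst (_≤ q + i ∸ k) (column-pos (suc (rowLen i)) i≤k) (ℕ.∸-monoˡ-≤ k (ℕ.+-monoˡ-≤ i (ℕ.≮⇒≥ q≮P)))

    weight-nextRow : ∀ δ → Untouched i δ → ∀ q → weight (suc i) 1 q (at δ q) ≤ weight i (suc (rowLen i)) q (at δ q)
    weight-nextRow δ unt q with ℕ.<-cmp q (pos (suc i) 1)
    ... | tri< q<p _ _ =
      ℕ.≤-reflexive (trans (weight-< (suc i) 1 (at δ q) q<p) (if-zero (at δ q) (cong (col (suc (suc i))) col≡0))) ⟨ ℕ.≤-trans ⟩ z≤n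
      where
      col≡0 : q + suc i ∸ k ≡ 0
      col≡0 = trans (cong (_∸ k) (ℕ.+-suc q i)) (column-untouched i≤k (subst (q <_) pos-first q<p))
    ... | tri≈ _ refl _ = ℕ.≤-reflexive (trans (cong (weight (suc i) 1 q) plus-first) (weight-≡ (suc i) 1 true)) ⟨ ℕ.≤-trans ⟩ z≤n
      where
      plus-first : at δ (pos (suc i) 1) ≡ true
      plus-first = subst (λ q → at δ q ≡ true) (sym pos-first) (untouched-last δ unt)
    ... | tri> _ _ p<q = ℕ.≤-trans (ℕ.≤-reflexive (trans (weight-> (suc i) 1 (at δ q) p<q)
                           (cong (λ c → if at δ q then col (suc i) c else 0) (cong (_∸ suc k) (ℕ.+-suc q i)))))
                           (plus-weight≤ q (at δ q))

    Good-nextRow : ∀ {t} → Good i (suc (rowLen i)) t → Good (suc i) 1 t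
    Good-nextRow {c , δ} (good len unt c∈O) = good len (Untouched-next δ unt)
      (∈O-weaken (s≤s (sumTo-mono-≤ n λ q _ _ → weight-nextRow δ unt q)) c∈O)

    Inv-nextRow : ∀ {μ m} → Inv i (suc (rowLen i)) μ m → Inv (suc i) 1 μ m
    Inv-nextRow (inv before after c split one good-before good-after mi) =
      inv before after c split one (All.map Good-nextRow good-before) (All.map Good-nextRow good-after) (IsMain-nextRow mi)

  pos-1-1 : pos 1 1 ≡ k
  pos-1-1 = ℕ.m+n∸n≡m k 1

  IsMain-oneSeq : IsMain 1 1 (oneSeq n k)
  IsMain-oneSeq = isMain (length-oneSeq n k (ℕ.<⇒≤ k<n))
    (subst (λ q → at (oneSeq n k) q ≡ true) (sym pos-1-1) (at-++-replicate-≤ k (n ∸ k) k 1≤k ℕ.≤-refl))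
    (λ q q<p _ → ℕ.<⇒≤pred (subst (q <_) pos-1-1 q<p))
    (λ q p<q _ → at-++-replicate-> k (n ∸ k) q (subst (_< q) pos-1-1 p<q))
    (λ q 1≤q q≤ → at-++-replicate-≤ k (n ∸ k) q 1≤q (ℕ.≤-trans q≤ (ℕ.m∸n≤m k 1)))

  Inv-start : Inv 1 1 (oneSeq n k) (basis (oneSeq n k))
  Inv-start = inv [] [] fone refl IsOne-fone [] [] IsMain-oneSeq

  rowSwaps : ℕ → Seq → Seq
  rowSwaps i = forUp (rowLen i) λ j → swapAt (pos i j)

  rowFactors : ℕ → Mod → Mod
  rowFactors i = forUp (rowLen i) λ j → factorAct (pos i j) (shiftc (shift lam i j))

  Inv-row : ∀ {i μ m} → 1 ≤ i → i ≤ k → Inv i 1 μ m → Inv i (suc (rowLen i)) (rowSwaps i μ) (rowFactors i m)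
  Inv-row {i} 1≤i i≤k I =
    forUp-ind (λ j → Inv i (suc j)) {λ j → swapAt (pos i j)} {λ j → factorAct (pos i j) (shiftc (shift lam i j))} (rowLen i) I
      λ j j<row → AtBox.Inv-step (box 1≤i i≤k (s≤s z≤n) j<row)

  AfterRows : ℕ → Seq → Mod → Set
  AfterRows zero    = Inv 1 1
  AfterRows (suc i) = Inv (suc i) (suc (rowLen (suc i)))

  nrows≤k : nrows lam ≤ k
  nrows≤k = subst (nrows lam ≤_) (proj₁ diag) (List.length-filter (1 ℕ.≤?_) lam)

  X·1 : Mod
  X·1 = XAct k lam (basis (oneSeq n k))

  w·1 : Seq
  w·1 = wAct k lam (oneSeq n k)

  AfterRows-all : AfterRows (nrows lam) w·1 X·1
  AfterRows-all = forUp-ind AfterRows {rowSwaps} {rowFactors} (nrows lam) Inv-start step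
    where
    step : ∀ i → i < nrows lam → ∀ {μ m} → AfterRows i μ m → AfterRows (suc i) (rowSwaps (suc i) μ) (rowFactors (suc i) m)
    step zero    _   I = Inv-row (s≤s z≤n) 1≤k I
    step (suc i) i<ℓ I = Inv-row (s≤s z≤n) i+2≤k (NextRow.Inv-nextRow (s≤s z≤n) i+2≤k I)
      where
      i+2≤k : suc (suc i) ≤ k
      i+2≤k = ℕ.≤-trans i<ℓ nrows≤k

  AfterRows⇒Inv : ∀ i {μ m} → AfterRows i μ m → ∃₂ λ i′ j → Inv i′ j μ m
  AfterRows⇒Inv zero    I = 1 , 1 , I
  AfterRows⇒Inv (suc i) I = suc i , suc (rowLen (suc i)) , I

  Good⇒Coeff∈O : ∀ {i j t} → Good i j t → Coeff∈O[v] t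
  Good⇒Coeff∈O g = ∈O-weaken (s≤s z≤n) (coeff-order g)

  coeff-main : ∀ {i j μ m} → Inv i j μ m → coeff m μ ∈1+O[v]
  coeff-main {μ = μ} (inv before after c refl one good-before good-after _) =
    coeff-++ _∈1+O[v] ∈1+O-faddˡ μ (All.map Good⇒Coeff∈O good-before) main-term
    where
    main-term : coeff ((c , μ) ∷ after) μ ∈1+O[v]
    main-term with List.≡-dec Bool._≟_ μ μ
    ... | yes _   = ∈1+O-faddʳ (IsOne⇒∈1+O one) (coeff-∈O μ (All.map Good⇒Coeff∈O good-after))
    ... | no  μ≢μ = contradiction refl μ≢μ

  coeff-other : ∀ {i j μ m} ε → μ ≢ ε → Inv i j μ m → coeff m ε ∈O[v^ 1 ]
  coeff-other {μ = μ} ε μ≢ε (inv before after c refl one good-before good-after _) =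
    coeff-++ (_∈O[v^ 1 ]) ∈O-fadd ε (All.map Good⇒Coeff∈O good-before) other-term
    where
    other-term : coeff ((c , μ) ∷ after) ε ∈O[v^ 1 ]
    other-term with List.≡-dec Bool._≟_ μ ε
    ... | yes μ≡ε = contradiction μ≡ε μ≢ε
    ... | no  _   = coeff-∈O ε (All.map Good⇒Coeff∈O good-after)

  Inv-final : ∃₂ λ i j → Inv i j w·1 X·1
  Inv-final = AfterRows⇒Inv (nrows lam) AfterRows-all

  coeff-X·1-main : coeff X·1 w·1 ∈1+O[v]
  coeff-X·1-main = coeff-main (proj₂ (proj₂ Inv-final))

  coeff-X·1-other : ∀ ε → w·1 ≢ ε → coeff X·1 ε ∈O[v^ 1 ]
  coeff-X·1-other ε w≢ε = coeff-other ε w≢ε (proj₂ (proj₂ Inv-final))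

proposition2p4 : (n k : ℕ) → 1 ≤ k → k < n → (lam : List ℕ) → IsDiagram n k lam →
    Σ (Seq → Frac) λ f → ((∀ ε → InE n k ε → InO (f ε)) ×
            (∀ ε → InE n k ε →
              coeff (XAct k lam (basis (oneSeq n k))) ε
                ≈F fadd (coeff (basis (wAct k lam (oneSeq n k))) ε) (f ε)))
proposition2p4 n k 1≤k k<n lam diag = error , error∈O , λ ε _ → ≈F-fadd-fsub (coeff X·1 ε) (coeff (basis w·1) ε)
  where
  open Construction n k lam 1≤k k<n diag
  error : Seq → Frac
  error ε = fsub (coeff X·1 ε) (coeff (basis w·1) ε)
  error∈O : ∀ ε → InE n k ε → InO (error ε)
  error∈O ε _ with List.≡-dec Bool._≟_ w·1 ε
  ... | yes refl = ∈O[v]⇒InO (∈1+O-fsub coeff-X·1-main (∈1+O-faddʳ (IsOne⇒∈1+O IsOne-fone) ∈O-fzero))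
  ... | no  w≢ε  = ∈O[v]⇒InO (∈O-fadd (coeff-X·1-other ε w≢ε) (∈O-fneg ∈O-fzero))
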